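{- In $GP(n,2)$, for the outer vertex $u_0$, $U=\{u_0,\dots,u_{n-1}\}$ and $V=\{v_0,\dots,v_{n-1}\}$, $$B(u_0,U|V)=\begin{cases}\frac12(n-1) & n\text{ odd},\ n\ge 13,\\ \frac n2 & n \text{ even},\ n\ge 12.\end{cases}$$
   Context: For an integer $n\ge 5$, $GP(n,2)$ is the graph with vertex set $\{u_0,\dots,u_{n-1},v_0,\dots,v_{n-1}\}$ and edges $u_iu_{i+1}$, $u_iv_i$, $v_iv_{i+2}$ ($0\le i\le n-1$, subscripts modulo $n$). For vertices $s,t,x$ of a graph $G$, $\sigma_{st}$ is the number of shortest $s$–$t$ paths and $\sigma_{st}(x)$ the number of those passing through $x$. For disjoint $S,T\subseteq V(G)$, $B(x,S|T)=\sum_{s\in S\setminus\{x\},\,t\in T\setminus\{x\}}\sigma_{st}(x)/\sigma_{st}$. -}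

module Defs where

open import Data.Nat using (ℕ; zero; suc; _+_; _*_; _%_; NonZero)
open import Data.Bool using (Bool; true; false; if_then_else_)
import Data.Bool.Properties as BoolP
open import Data.Fin using (Fin; toℕ)
import Data.Fin.Properties as FinP
open import Data.Product using (_×_; _,_)
open import Data.Product.Properties using (≡-dec)
open import Data.Sum using (_⊎_)
open import Data.List using (List; []; _∷_; map; concatMap; filter; length; null; foldr; allFin; cartesianProduct)
import Data.List
import Data.Nat
import Data.Product
import Relation.Nullary
import Data.List.Membership.Propositional
open import Data.List.Membership.DecPropositional using ()
open import Data.List.Relation.Unary.Any using (any?)
open import Data.Integer using (+_)
open import Data.Rational using (ℚ; _/_) renaming (0ℚ to q0; _+_ to _+q_)
open import Relation.Binary.PropositionalEquality using (_≡_)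
open import Relation.Binary.Definitions using (DecidableEquality)
open import Relation.Nullary using (Dec; yes; no)
open import Relation.Nullary.Decidable using (_⊎-dec_; ⌊_⌋)

-- Vertices of GP(n,2): (true , i) is the outer vertex u_i, (false , i) is the inner vertex v_i.
Vtx : ℕ → Set
Vtx n = Bool × Fin n

u : ∀ {n} → Fin n → Vtx n
u i = (true , i)

v : ∀ {n} → Fin n → Vtx n
v i = (false , i)

_≟V_ : ∀ {n} → DecidableEquality (Vtx n)
_≟V_ = ≡-dec BoolP._≟_ FinP._≟_

allVtx : (n : ℕ) → List (Vtx n)
allVtx n = map (true ,_) (allFin n) Data.List.++ map (false ,_) (allFin n)

step : (n : ℕ) {{_ : NonZero n}} → ℕ → Fin n → Fin n → Set
step n k i j = ((toℕ i + k) % n ≡ toℕ j) ⊎ ((toℕ j + k) % n ≡ toℕ i)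

Adj : (n : ℕ) {{_ : NonZero n}} → Vtx n → Vtx n → Set
Adj n (true  , i) (true  , j) = step n 1 i j
Adj n (false , i) (false , j) = step n 2 i j
Adj n (true  , i) (false , j) = i ≡ j
Adj n (false , i) (true  , j) = i ≡ j

step? : (n : ℕ) {{_ : NonZero n}} (k : ℕ) (i j : Fin n) → Dec (step n k i j)
step? n k i j = (Data.Nat._≟_ ((toℕ i + k) % n) (toℕ j)) ⊎-dec (Data.Nat._≟_ ((toℕ j + k) % n) (toℕ i))

Adj? : (n : ℕ) {{_ : NonZero n}} (x y : Vtx n) → Dec (Adj n x y)
Adj? n (true  , i) (true  , j) = step? n 1 i j
Adj? n (false , i) (false , j) = step? n 2 i j
Adj? n (true  , i) (false , j) = i FinP.≟ j
Adj? n (false , i) (true  , j) = i FinP.≟ j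

neighbours : (n : ℕ) {{_ : NonZero n}} → Vtx n → List (Vtx n)
neighbours n x = filter (Adj? n x) (allVtx n)

walks : (n : ℕ) {{_ : NonZero n}} → ℕ → Vtx n → Vtx n → List (List (Vtx n))
walks n zero    s t with s ≟V t
... | yes _ = (s ∷ []) ∷ []
... | no  _ = []
walks n (suc k) s t = concatMap (λ w → map (s ∷_) (walks n k w t)) (neighbours n s)

-- Distance: least k with a walk of length k from s to t (searched up to 2n,
-- which suffices since GP(n,2) is connected on 2n vertices).
distSearch : (n : ℕ) {{_ : NonZero n}} → Vtx n → Vtx n → ℕ → ℕ → ℕ
distSearch n s t k zero    = k
distSearch n s t k (suc f) = if null (walks n k s t) then distSearch n s t (suc k) f else k

dist : (n : ℕ) {{_ : NonZero n}} → Vtx n → Vtx n → ℕ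
dist n s t = distSearch n s t 0 (2 * n)

-- Shortest s–t paths (walks of length dist s t; these are automatically paths).
shortestPaths : (n : ℕ) {{_ : NonZero n}} → Vtx n → Vtx n → List (List (Vtx n))
shortestPaths n s t = walks n (dist n s t) s t

σ : (n : ℕ) {{_ : NonZero n}} → Vtx n → Vtx n → ℕ
σ n s t = length (shortestPaths n s t)

_∈?_ : ∀ {n} (x : Vtx n) (p : List (Vtx n)) → Dec (Data.List.Membership.Propositional._∈_ x p)
x ∈? p = any? (x ≟V_) p

σvia : (n : ℕ) {{_ : NonZero n}} → Vtx n → Vtx n → Vtx n → ℕ
σvia n s t x = length (filter (x ∈?_) (shortestPaths n s t))

-- a / b as a rational (b = 0 gives 0; never occurs since the graph is connected)
frac : ℕ → ℕ → ℚ
frac a zero    = q0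
frac a (suc b) = (+ a) / suc b

sumℚ : List ℚ → ℚ
sumℚ = foldr _+q_ q0

B : (n : ℕ) {{_ : NonZero n}} → Vtx n → List (Vtx n) → List (Vtx n) → ℚ
B n x S T = sumℚ (map (λ st → frac (σvia n (Data.Product.proj₁ st) (Data.Product.proj₂ st) x)
                                   (σ n (Data.Product.proj₁ st) (Data.Product.proj₂ st)))
                     (cartesianProduct (filter (λ s → Relation.Nullary.¬? (s ≟V x)) S)
                                       (filter (λ t → Relation.Nullary.¬? (t ≟V x)) T)))

Uset : (n : ℕ) → List (Vtx n)
Uset n = map u (allFin n)

Vset : (n : ℕ) → List (Vtx n)
Vset n = map v (allFin n)

-- Distances in GP(n,2) have a closed form: the distance from (b , i) to (c , j) is the
-- distance from (b , 0) to (c , a) in the infinite ladder GP(ℤ,2), minimised over the two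
-- circular offsets a between i and j.  For n ≥ 5 this formula is 1-Lipschitz along edges and
-- every vertex has a neighbour one step closer to the target, so it is the graph distance,
-- and geodesics can be counted neighbour by neighbour.  For a pair (u c , v j), u 0 can lie on
-- a geodesic only when u c is a neighbour of u 0, i.e. c = 1 or c = n - 1.  In each of these
-- two rows the share of geodesics through u 0 is 0, 1/2 or 1, depending on how far v j lies
-- beyond u 0 the other way round, and a row adds up to ⌊n/2⌋/2.  Hence B(u 0, U | V) = ⌊n/2⌋,
-- in fact for every n ≥ 5.

module Submission where

open import Defs
open import Data.Bool using (Bool; true; false; not)
open import Data.Empty using (⊥; ⊥-elim)
open import Data.Fin using (Fin; toℕ; fromℕ<; zero; suc)
open import Data.Fin.Properties using (toℕ<n; toℕ-injective; toℕ-fromℕ<)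
import Data.Integer.Properties as ℤ
open import Data.List using (List; []; _∷_; _++_; map; concatMap; filter; length; null; allFin; tabulate; cartesianProduct)
open import Data.List.Properties using (length-++; length-map; length-filter; filter-++; filter-all; filter-none; filter-≐)
open import Data.List.Membership.Propositional using (_∈_; find; lose)
open import Data.List.Membership.Propositional.Properties
import Data.List.Relation.Unary.All as All
open import Data.List.Relation.Unary.Any using (here; there)
open import Data.List.Relation.Unary.AllPairs using (_∷_)
open import Data.List.Relation.Unary.Unique.Propositional using (Unique)
import Data.List.Relation.Unary.Unique.Propositional.Properties as Unique
open import Data.Nat hiding (_/_)
open import Data.Nat.Properties
open import Data.Nat.DivMod using (m≤n⇒[n∸m]%m≡n%m; m%n≤m; %-distribˡ-+; [m+n]%n≡m%n; m%n%n≡m%n; m%n<n; m<n⇒m%n≡m; n%n≡0)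
open import Data.Nat.Solver using (module +-*-Solver)
open import Data.Product using (∃; _×_; _,_; proj₁; proj₂)
open import Data.Rational using (ℚ; _/_; toℚᵘ) renaming (_+_ to _+ℚ_)
open import Data.Rational.Properties using (0/n≡0; fromℚᵘ-cong; toℚᵘ-injective; toℚᵘ-homo-+; toℚᵘ-fromℚᵘ)
import Data.Rational.Unnormalised as ℚᵘ
import Data.Rational.Unnormalised.Properties as ℚᵘₚ
open import Data.Sum using (_⊎_; inj₁; inj₂)
open import Function using (_∘_)
open import Relation.Binary.PropositionalEquality hiding (J)
open import Relation.Nullary using (Dec; yes; no; ¬_; ¬?)
open import Relation.Unary using (Decidable)
open +-*-Solver

private
  variable
    A C : Set

∑ : (A → ℕ) → List A → ℕ
∑ f []       = 0
∑ f (x ∷ xs) = f x + ∑ f xs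

∑-cong : ∀ xs {f h : A → ℕ} → (∀ {x} → x ∈ xs → f x ≡ h x) → ∑ f xs ≡ ∑ h xs
∑-cong []       f≡h = refl
∑-cong (x ∷ xs) f≡h = cong₂ _+_ (f≡h (here refl)) (∑-cong xs (f≡h ∘ there))

∑-zero : ∀ xs {f : A → ℕ} → (∀ {x} → x ∈ xs → f x ≡ 0) → ∑ f xs ≡ 0
∑-zero []       f≡0 = refl
∑-zero (x ∷ xs) f≡0 rewrite f≡0 (here refl) = ∑-zero xs (f≡0 ∘ there)

∑-single : ∀ {xs} {f : A → ℕ} {y} → Unique xs → y ∈ xs →
           (∀ {x} → x ∈ xs → x ≢ y → f x ≡ 0) → ∑ f xs ≡ f y
∑-single {xs = x ∷ xs} {f = f} (x∉xs ∷ _) (here refl) f≡0 =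
  trans (cong (f x +_) (∑-zero xs (λ x′∈xs → f≡0 (there x′∈xs) (All.lookup x∉xs x′∈xs ∘ sym))))
        (+-identityʳ (f x))
∑-single {xs = x ∷ xs} (x∉xs ∷ uniq) (there y∈xs) f≡0
  rewrite f≡0 (here refl) (All.lookup x∉xs y∈xs) = ∑-single uniq y∈xs (f≡0 ∘ there)

∑-pair : ∀ {xs} {f : A → ℕ} {y z} → Unique xs → y ∈ xs → z ∈ xs → y ≢ z →
         (∀ {x} → x ∈ xs → x ≢ y → x ≢ z → f x ≡ 0) → ∑ f xs ≡ f y + f z
∑-pair (_ ∷ _) (here refl) (here refl) y≢z _ = ⊥-elim (y≢z refl)
∑-pair {xs = x ∷ _} {f = f} (x∉xs ∷ uniq) (here refl) (there z∈xs) _ f≡0 =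
  cong (f x +_) (∑-single uniq z∈xs (λ x′∈xs → f≡0 (there x′∈xs) (All.lookup x∉xs x′∈xs ∘ sym)))
∑-pair {xs = x ∷ _} {f = f} {y = y} (x∉xs ∷ uniq) (there y∈xs) (here refl) _ f≡0 =
  trans (cong (f x +_) (∑-single uniq y∈xs (λ x′∈xs x′≢y → f≡0 (there x′∈xs) x′≢y (All.lookup x∉xs x′∈xs ∘ sym))))
        (+-comm (f x) (f y))
∑-pair (x∉xs ∷ uniq) (there y∈xs) (there z∈xs) y≢z f≡0
  rewrite f≡0 (here refl) (All.lookup x∉xs y∈xs) (All.lookup x∉xs z∈xs) =
  ∑-pair uniq y∈xs z∈xs y≢z (f≡0 ∘ there)

∑-++ : ∀ (f : A → ℕ) xs ys → ∑ f (xs ++ ys) ≡ ∑ f xs + ∑ f ys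
∑-++ f []       ys = refl
∑-++ f (x ∷ xs) ys = trans (cong (f x +_) (∑-++ f xs ys)) (sym (+-assoc (f x) _ _))

∑-map : ∀ (f : C → ℕ) (g : A → C) xs → ∑ f (map g xs) ≡ ∑ (f ∘ g) xs
∑-map f g []       = refl
∑-map f g (x ∷ xs) = cong (f (g x) +_) (∑-map f g xs)

∑-cartesianProduct : ∀ (f : A × C → ℕ) xs ys →
                     ∑ f (cartesianProduct xs ys) ≡ ∑ (λ x → ∑ (λ y → f (x , y)) ys) xs
∑-cartesianProduct f []       ys = refl
∑-cartesianProduct f (x ∷ xs) ys =
  trans (∑-++ f (map (x ,_) ys) _) (cong₂ _+_ (∑-map f (x ,_) ys) (∑-cartesianProduct f xs ys))

∑-filter-all : ∀ {P : A → Set} (P? : Decidable P) (f : A → ℕ) xs →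
               (∀ {x} → x ∈ xs → P x) → ∑ f (filter P? xs) ≡ ∑ f xs
∑-filter-all P? f xs allP = cong (∑ f) (filter-all P? (All.tabulate allP))

length-concatMap : ∀ (f : C → List A) xs → length (concatMap f xs) ≡ ∑ (length ∘ f) xs
length-concatMap f []       = refl
length-concatMap f (x ∷ xs) = trans (length-++ (f x)) (cong (length (f x) +_) (length-concatMap f xs))

length-filter-concatMap : ∀ {P : A → Set} (P? : Decidable P) (f : C → List A) xs →
                          length (filter P? (concatMap f xs)) ≡ ∑ (λ x → length (filter P? (f x))) xs
length-filter-concatMap P? f []       = refl
length-filter-concatMap P? f (x ∷ xs) = begin
  length (filter P? (f x ++ concatMap f xs))
    ≡⟨ cong length (filter-++ P? (f x) (concatMap f xs)) ⟩
  length (filter P? (f x) ++ filter P? (concatMap f xs))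
    ≡⟨ length-++ (filter P? (f x)) ⟩
  length (filter P? (f x)) + length (filter P? (concatMap f xs))
    ≡⟨ cong (length (filter P? (f x)) +_) (length-filter-concatMap P? f xs) ⟩
  length (filter P? (f x)) + ∑ (λ x → length (filter P? (f x))) xs ∎
  where open ≡-Reasoning

length-filter-map : ∀ {P : A → Set} (P? : Decidable P) (g : C → A) xs →
                    length (filter P? (map g xs)) ≡ length (filter (P? ∘ g) xs)
length-filter-map P? g []       = refl
length-filter-map P? g (x ∷ xs) with P? (g x)
... | yes _ = cong suc (length-filter-map P? g xs)
... | no  _ = length-filter-map P? g xs

∑< : ℕ → (ℕ → ℕ) → ℕ
∑< zero    f = 0
∑< (suc k) f = f 0 + ∑< k (f ∘ suc)

∑<-cong : ∀ k {f h : ℕ → ℕ} → (∀ {i} → i < k → f i ≡ h i) → ∑< k f ≡ ∑< k h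
∑<-cong zero    f≡h = refl
∑<-cong (suc k) f≡h = cong₂ _+_ (f≡h z<s) (∑<-cong k (f≡h ∘ s<s))

∑<-zero : ∀ k {f : ℕ → ℕ} → (∀ {i} → i < k → f i ≡ 0) → ∑< k f ≡ 0
∑<-zero zero    f≡0 = refl
∑<-zero (suc k) f≡0 rewrite f≡0 z<s = ∑<-zero k (f≡0 ∘ s<s)

∑<-+ : ∀ a b (f : ℕ → ℕ) → ∑< (a + b) f ≡ ∑< a f + ∑< b (λ i → f (a + i))
∑<-+ zero    b f = refl
∑<-+ (suc a) b f = trans (cong (f 0 +_) (∑<-+ a b (f ∘ suc))) (sym (+-assoc (f 0) _ _))

∑<-suc : ∀ k (f : ℕ → ℕ) → ∑< (suc k) f ≡ ∑< k f + f k
∑<-suc k f = begin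
  ∑< (suc k) f             ≡⟨ cong (λ l → ∑< l f) (+-comm 1 k) ⟩
  ∑< (k + 1) f             ≡⟨ ∑<-+ k 1 f ⟩
  ∑< k f + (f (k + 0) + 0) ≡⟨ cong (∑< k f +_) (trans (+-identityʳ _) (cong f (+-identityʳ k))) ⟩
  ∑< k f + f k             ∎
  where open ≡-Reasoning

∑<-reverse : ∀ k (f : ℕ → ℕ) → ∑< k (λ i → f (k ∸ i)) ≡ ∑< k (f ∘ suc)
∑<-reverse zero    f = refl
∑<-reverse (suc k) f = begin
  f (suc k) + ∑< k (λ i → f (k ∸ i)) ≡⟨ cong (f (suc k) +_) (∑<-reverse k f) ⟩
  f (suc k) + ∑< k (f ∘ suc)         ≡⟨ +-comm (f (suc k)) _ ⟩
  ∑< k (f ∘ suc) + f (suc k)         ≡⟨ ∑<-suc k (f ∘ suc) ⟨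
  ∑< (suc k) (f ∘ suc)               ∎
  where open ≡-Reasoning

∑-tabulate : ∀ k (g : Fin k → A) (f : A → ℕ) (h : ℕ → ℕ) →
             (∀ i → f (g i) ≡ h (toℕ i)) → ∑ f (tabulate g) ≡ ∑< k h
∑-tabulate zero    g f h fg≡h = refl
∑-tabulate (suc k) g f h fg≡h = cong₂ _+_ (fg≡h zero) (∑-tabulate k (g ∘ suc) f (h ∘ suc) (fg≡h ∘ suc))

length-∈ : ∀ {xs : List A} {x} → x ∈ xs → 0 < length xs
length-∈ {xs = _ ∷ _} _ = z<s

length-∉ : ∀ (xs : List A) → (∀ {x} → x ∈ xs → ⊥) → length xs ≡ 0
length-∉ []      _   = refl
length-∉ (x ∷ _) ∉xs = ⊥-elim (∉xs (here refl))

null-∈ : ∀ {xs : List A} {x} → x ∈ xs → null xs ≡ false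
null-∈ {xs = _ ∷ _} _ = refl

null-∉ : ∀ (xs : List A) → (∀ {x} → x ∈ xs → ⊥) → null xs ≡ true
null-∉ []      _   = refl
null-∉ (x ∷ _) ∉xs = ⊥-elim (∉xs (here refl))

-- ladder b c a is the distance from (b , 0) to (c , a) in the infinite cover GP(ℤ,2) of GP(n,2)
-- (true for the outer, false for the inner rim): ladderUV runs down a spoke and then along the
-- inner rim, ladderUU either along the outer rim or through the inner rim.
ladderUV : ℕ → ℕ
ladderUV zero          = 1
ladderUV (suc zero)    = 2
ladderUV (suc (suc a)) = suc (ladderUV a)

ladderVV : ℕ → ℕ
ladderVV zero          = 0
ladderVV (suc zero)    = 3
ladderVV (suc (suc a)) = suc (ladderVV a)

ladderUU : ℕ → ℕ
ladderUU a = a ⊓ suc (ladderUV a)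

ladder : Bool → Bool → ℕ → ℕ
ladder true  true  = ladderUU
ladder true  false = ladderUV
ladder false true  = ladderUV
ladder false false = ladderVV

ladderUV-even : ∀ p → ladderUV (p + p) ≡ suc p
ladderUV-even zero    = refl
ladderUV-even (suc p) rewrite +-suc p p = cong suc (ladderUV-even p)

ladderUV-odd : ∀ p → ladderUV (suc (p + p)) ≡ suc (suc p)
ladderUV-odd zero    = refl
ladderUV-odd (suc p) rewrite +-suc p p = cong suc (ladderUV-odd p)

ladderVV-even : ∀ p → ladderVV (p + p) ≡ p
ladderVV-even zero    = refl
ladderVV-even (suc p) rewrite +-suc p p = cong suc (ladderVV-even p)

ladderVV-odd : ∀ p → ladderVV (suc (p + p)) ≡ 3 + p
ladderVV-odd zero    = refl
ladderVV-odd (suc p) rewrite +-suc p p = cong suc (ladderVV-odd p)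

ladderUV-+2 : ∀ a → ladderUV (a + 2) ≡ suc (ladderUV a)
ladderUV-+2 a rewrite +-comm a 2 = refl

ladderVV-+2 : ∀ a → ladderVV (a + 2) ≡ suc (ladderVV a)
ladderVV-+2 a rewrite +-comm a 2 = refl

ladderUV-suc-≤ : ∀ a → ladderUV (suc a) ≤ suc (ladderUV a)
ladderUV-suc-≤ zero          = ≤-refl
ladderUV-suc-≤ (suc zero)    = s≤s (s≤s z≤n)
ladderUV-suc-≤ (suc (suc a)) = s≤s (ladderUV-suc-≤ a)

ladderUV-≤-suc : ∀ a → ladderUV a ≤ ladderUV (suc a)
ladderUV-≤-suc zero          = s≤s z≤n
ladderUV-≤-suc (suc zero)    = s≤s (s≤s z≤n)
ladderUV-≤-suc (suc (suc a)) = s≤s (ladderUV-≤-suc a)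

ladderUV-mono-≤ : ∀ {a b} → a ≤ b → ladderUV a ≤ ladderUV b
ladderUV-mono-≤ {a} a≤b with m≤n⇒∃[o]m+o≡n a≤b
... | o , refl = go o
  where
  go : ∀ o → ladderUV a ≤ ladderUV (a + o)
  go zero    rewrite +-identityʳ a = ≤-refl
  go (suc o) rewrite +-suc a o     = ≤-trans (go o) (ladderUV-≤-suc (a + o))

ladderUU-mono-≤ : ∀ {a b} → a ≤ b → ladderUU a ≤ ladderUU b
ladderUU-mono-≤ a≤b = ⊓-mono-≤ a≤b (s≤s (ladderUV-mono-≤ a≤b))

ladderUU-suc-≤ : ∀ a → ladderUU (suc a) ≤ suc (ladderUU a)
ladderUU-suc-≤ a = ⊓-mono-≤ (≤-refl {suc a}) (s≤s (ladderUV-suc-≤ a))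

ladderUV-≤ : ∀ a → ladderUV a ≤ suc a
ladderUV-≤ zero          = ≤-refl
ladderUV-≤ (suc zero)    = ≤-refl
ladderUV-≤ (suc (suc a)) = s≤s (≤-trans (ladderUV-≤ a) (n≤1+n _))

ladderVV-≤-ladderUV : ∀ a → ladderVV a ≤ suc (ladderUV a)
ladderVV-≤-ladderUV zero          = z≤n
ladderVV-≤-ladderUV (suc zero)    = ≤-refl
ladderVV-≤-ladderUV (suc (suc a)) = s≤s (ladderVV-≤-ladderUV a)

ladderUV-≤-ladderVV : ∀ a → ladderUV a ≤ suc (ladderVV a)
ladderUV-≤-ladderVV zero          = ≤-refl
ladderUV-≤-ladderVV (suc zero)    = s≤s (s≤s z≤n)
ladderUV-≤-ladderVV (suc (suc a)) = s≤s (ladderUV-≤-ladderVV a)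

ladderVV-≤-+5 : ∀ a o → ladderVV a ≤ ladderVV (5 + a + o)
ladderVV-≤-+5 zero          o             = z≤n
ladderVV-≤-+5 (suc zero)    zero          = s≤s (s≤s (s≤s z≤n))
ladderVV-≤-+5 (suc zero)    (suc zero)    = s≤s (s≤s (s≤s z≤n))
ladderVV-≤-+5 (suc zero)    (suc (suc o)) = ≤-trans (ladderVV-≤-+5 1 o) (n≤1+n _)
ladderVV-≤-+5 (suc (suc a)) o             = s≤s (ladderVV-≤-+5 a o)

-- ladderVV is not monotone (ladderVV 1 = 3 > ladderVV 2), but it is up to a gap of 5.
ladder-mono-≤₅ : ∀ b c {a a′} → 5 + a ≤ a′ → ladder b c a ≤ ladder b c a′
ladder-mono-≤₅ b c {a} a+5≤a′ with m≤n⇒∃[o]m+o≡n a+5≤a′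
... | o , refl = go b c
  where
  a≤a′ : a ≤ 5 + a + o
  a≤a′ = ≤-trans (m≤n+m a 5) (m≤m+n (5 + a) o)
  go : ∀ b c → ladder b c a ≤ ladder b c (5 + a + o)
  go true  true  = ladderUU-mono-≤ a≤a′
  go true  false = ladderUV-mono-≤ a≤a′
  go false true  = ladderUV-mono-≤ a≤a′
  go false false = ladderVV-≤-+5 a o

ladder-≤ : ∀ b c a → ladder b c a ≤ 3 + a
ladder-≤ true  true  a = ≤-trans (m⊓n≤m a _) (m≤n+m a 3)
ladder-≤ true  false a = ≤-trans (ladderUV-≤ a) (s≤s (m≤n+m a 2))
ladder-≤ false true  a = ladder-≤ true false a
ladder-≤ false false a = go a
  where
  go : ∀ a → ladderVV a ≤ 3 + a
  go zero          = z≤n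
  go (suc zero)    = s≤s (s≤s (s≤s z≤n))
  go (suc (suc a)) = s≤s (≤-trans (go a) (n≤1+n _))

stepLength : Bool → Bool → ℕ
stepLength true  true  = 1
stepLength false false = 2
stepLength true  false = 0
stepLength false true  = 0

-- p and q are the offsets from a fixed target index of the two ends of an edge that moves the
-- index by k (1 on the outer rim, 2 on the inner rim, 0 along a spoke); in the third case the
-- edge passes over the target.
OffsetStep : ℕ → ℕ → ℕ → Set
OffsetStep k p q = (k + q ≡ p) ⊎ (k + p ≡ q) ⊎ (p + q ≡ k) ⊎ (p ≡ q)

lipschitz-rim₁ : ∀ (f : ℕ → ℕ) → (∀ a → f (suc a) ≤ suc (f a)) → (∀ a → f a ≤ suc (f (suc a))) →
                 ∀ {p q} → OffsetStep 1 p q → f q ≤ suc (f p)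
lipschitz-rim₁ f up down (inj₁ refl)        = down _
lipschitz-rim₁ f up down (inj₂ (inj₁ refl)) = up _
lipschitz-rim₁ f up down {zero}        {suc zero}    (inj₂ (inj₂ (inj₁ refl))) = up 0
lipschitz-rim₁ f up down {suc zero}    {zero}        (inj₂ (inj₂ (inj₁ refl))) = down 0
lipschitz-rim₁ f up down {zero}        {zero}        (inj₂ (inj₂ (inj₁ ())))
lipschitz-rim₁ f up down {zero}        {suc (suc _)} (inj₂ (inj₂ (inj₁ ())))
lipschitz-rim₁ f up down {suc zero}    {suc _}       (inj₂ (inj₂ (inj₁ ())))
lipschitz-rim₁ f up down {suc (suc _)}               (inj₂ (inj₂ (inj₁ ())))
lipschitz-rim₁ f up down (inj₂ (inj₂ (inj₂ refl))) = n≤1+n _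

lipschitz-rim₂ : ∀ (f : ℕ → ℕ) → (∀ a → f (2 + a) ≤ suc (f a)) → (∀ a → f a ≤ suc (f (2 + a))) →
                 ∀ {p q} → OffsetStep 2 p q → f q ≤ suc (f p)
lipschitz-rim₂ f up down (inj₁ refl)        = down _
lipschitz-rim₂ f up down (inj₂ (inj₁ refl)) = up _
lipschitz-rim₂ f up down {zero}              {suc (suc zero)}    (inj₂ (inj₂ (inj₁ refl))) = up 0
lipschitz-rim₂ f up down {suc (suc zero)}    {zero}              (inj₂ (inj₂ (inj₁ refl))) = down 0
lipschitz-rim₂ f up down {suc zero}          {suc zero}          (inj₂ (inj₂ (inj₁ refl))) = n≤1+n _
lipschitz-rim₂ f up down {zero}              {zero}              (inj₂ (inj₂ (inj₁ ())))
lipschitz-rim₂ f up down {zero}              {suc zero}          (inj₂ (inj₂ (inj₁ ())))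
lipschitz-rim₂ f up down {zero}              {suc (suc (suc _))} (inj₂ (inj₂ (inj₁ ())))
lipschitz-rim₂ f up down {suc zero}          {zero}              (inj₂ (inj₂ (inj₁ ())))
lipschitz-rim₂ f up down {suc zero}          {suc (suc _)}       (inj₂ (inj₂ (inj₁ ())))
lipschitz-rim₂ f up down {suc (suc zero)}    {suc _}             (inj₂ (inj₂ (inj₁ ())))
lipschitz-rim₂ f up down {suc (suc (suc _))}                     (inj₂ (inj₂ (inj₁ ())))
lipschitz-rim₂ f up down (inj₂ (inj₂ (inj₂ refl))) = n≤1+n _

lipschitz-spoke : ∀ (f f′ : ℕ → ℕ) → (∀ a → f′ a ≤ suc (f a)) → ∀ {p q} → OffsetStep 0 p q → f′ q ≤ suc (f p)
lipschitz-spoke f f′ f′≤f (inj₁ refl)        = f′≤f _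
lipschitz-spoke f f′ f′≤f (inj₂ (inj₁ refl)) = f′≤f _
lipschitz-spoke f f′ f′≤f {zero}  {zero}  (inj₂ (inj₂ (inj₁ refl))) = f′≤f 0
lipschitz-spoke f f′ f′≤f {zero}  {suc _} (inj₂ (inj₂ (inj₁ ())))
lipschitz-spoke f f′ f′≤f {suc _}         (inj₂ (inj₂ (inj₁ ())))
lipschitz-spoke f f′ f′≤f (inj₂ (inj₂ (inj₂ refl))) = f′≤f _

ladder-lipschitz : ∀ b b′ c {p q} → OffsetStep (stepLength b b′) p q → ladder b′ c q ≤ suc (ladder b c p)
ladder-lipschitz true  true  true  = lipschitz-rim₁ ladderUU ladderUU-suc-≤ (λ a → m≤n⇒m≤1+n (ladderUU-mono-≤ (n≤1+n a)))
ladder-lipschitz true  true  false = lipschitz-rim₁ ladderUV ladderUV-suc-≤ (λ a → m≤n⇒m≤1+n (ladderUV-≤-suc a))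
ladder-lipschitz false false true  = lipschitz-rim₂ ladderUV (λ _ → ≤-refl) (λ _ → m≤n⇒m≤1+n (n≤1+n _))
ladder-lipschitz false false false = lipschitz-rim₂ ladderVV (λ _ → ≤-refl) (λ _ → m≤n⇒m≤1+n (n≤1+n _))
ladder-lipschitz true  false true  = lipschitz-spoke ladderUU ladderUV (λ a → ⊓-glb (ladderUV-≤ a) (m≤n⇒m≤1+n (n≤1+n _)))
ladder-lipschitz false true  true  = lipschitz-spoke ladderUV ladderUU (λ a → m⊓n≤n a _)
ladder-lipschitz true  false false = lipschitz-spoke ladderUV ladderVV ladderVV-≤-ladderUV
ladder-lipschitz false true  false = lipschitz-spoke ladderVV ladderUV ladderUV-≤-ladderVV

LadderDescent : Bool → Bool → ℕ → Set
LadderDescent b c p = ∃ λ b′ → ∃ λ q → stepLength b b′ + q ≡ p × ladder b′ c q < ladder b c p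

ladderUV-descent : ∀ p → LadderDescent true false p
ladderUV-descent zero          = false , 0 , refl , s≤s z≤n
ladderUV-descent (suc zero)    = true , 0 , refl , ≤-refl
ladderUV-descent (suc (suc p)) with ladderUV-descent p
... | true  , q , refl , lt = true  , suc (suc q) , refl , s≤s lt
... | false , q , refl , lt = false , suc (suc q) , refl , s≤s lt

ladder-descent : ∀ b c p → 0 < ladder b c p → LadderDescent b c p
ladder-descent true  true  p pos with p ≤? suc (ladderUV p)
ladder-descent true  true  (suc r) pos | yes p≤ =
  true , r , refl , subst (ladderUU r <_) (sym (m≤n⇒m⊓n≡m p≤)) (s≤s (m⊓n≤m r _))
ladder-descent true  true  p pos | no p≰ =
  false , p , refl , ≤-reflexive (sym (m≥n⇒m⊓n≡n (<⇒≤ (≰⇒> p≰))))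
ladder-descent true  false p             pos = ladderUV-descent p
ladder-descent false true  zero          pos = true , 0 , refl , ≤-refl
ladder-descent false true  (suc zero)    pos = true , 1 , refl , s≤s (s≤s z≤n)
ladder-descent false true  (suc (suc p)) pos = false , p , refl , ≤-refl
ladder-descent false false (suc zero)    pos = true , 1 , refl , s≤s (s≤s (s≤s z≤n))
ladder-descent false false (suc (suc p)) pos = false , p , refl , ≤-refl

ladder≡0 : ∀ b c a → ladder b c a ≡ 0 → b ≡ c × a ≡ 0
ladder≡0 true  true  zero          _  = refl , refl
ladder≡0 false false zero          _  = refl , refl
ladder≡0 true  true  (suc a)       ()
ladder≡0 true  false (suc (suc a)) ()
ladder≡0 false true  (suc (suc a)) ()
ladder≡0 false false (suc (suc a)) ()

ladderVV-odd+ : ∀ p a → suc (suc p) ≤ ladderVV (3 + (p + p) + a)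
ladderVV-odd+ p zero          rewrite +-identityʳ (p + p) | ladderVV-odd p = s≤s (s≤s (m≤n⇒m≤1+n (n≤1+n p)))
ladderVV-odd+ p (suc zero)    rewrite +-comm (p + p) 1 | ladderVV-even p = ≤-refl
ladderVV-odd+ p (suc (suc a)) rewrite +-suc (p + p) (suc a) | +-suc (p + p) a = m≤n⇒m≤1+n (ladderVV-odd+ p a)

ladderUV-≤-self : ∀ a → 2 ≤ a → ladderUV a ≤ a
ladderUV-≤-self (suc zero)                (s≤s ())
ladderUV-≤-self (suc (suc zero))          _ = ≤-refl
ladderUV-≤-self (suc (suc (suc zero)))    _ = ≤-refl
ladderUV-≤-self (suc (suc (suc (suc a)))) _ = s≤s (≤-trans (ladderUV-≤-self (suc (suc a)) (s≤s (s≤s z≤n))) (n≤1+n _))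

ladderUV-+-< : ∀ a b → ladderUV (a + b) < ladderUV a + ladderUV b
ladderUV-+-< zero          b = ≤-refl
ladderUV-+-< (suc zero)    b = s≤s (ladderUV-suc-≤ b)
ladderUV-+-< (suc (suc a)) b = s≤s (ladderUV-+-< a b)

-- From an outer vertex, a detour to an inner vertex through the outer vertex at offset a ≥ 2
-- is never shortest.
ladderUV-<-detour : ∀ a b → 2 ≤ a → ladderUV (a + b) < ladderUU a + ladderUV b
ladderUV-<-detour a b 2≤a = subst (ladderUV (a + b) <_) (sym (+-distribʳ-⊓ (ladderUV b) a (suc (ladderUV a))))
  (⊓-glb (≤-trans (ladderUV-+-< a b) (+-monoˡ-≤ (ladderUV b) (ladderUV-≤-self a 2≤a)))
         (≤-trans (ladderUV-+-< a b) (+-monoˡ-≤ (ladderUV b) (n≤1+n _))))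

module Circular (n : ℕ) {{_ : NonZero n}} where

  infix 4 _≋_
  record _≋_ (x y : ℕ) : Set where
    constructor mk≋
    field ≋⇒%≡ : x % n ≡ y % n
  open _≋_ public

  ≋-refl : ∀ {x} → x ≋ x
  ≋-refl = mk≋ refl

  ≋-sym : ∀ {x y} → x ≋ y → y ≋ x
  ≋-sym (mk≋ e) = mk≋ (sym e)

  ≋-trans : ∀ {x y z} → x ≋ y → y ≋ z → x ≋ z
  ≋-trans (mk≋ e) (mk≋ f) = mk≋ (trans e f)

  ≡⇒≋ : ∀ {x y} → x ≡ y → x ≋ y
  ≡⇒≋ refl = ≋-refl

  +-congʳ-≋ : ∀ {x y} z → x ≋ y → x + z ≋ y + z
  +-congʳ-≋ {x} {y} z (mk≋ e) = mk≋ (begin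
    (x + z) % n           ≡⟨ %-distribˡ-+ x z n ⟩
    (x % n + z % n) % n   ≡⟨ cong (λ w → (w + z % n) % n) e ⟩
    (y % n + z % n) % n   ≡⟨ %-distribˡ-+ y z n ⟨
    (y + z) % n           ∎)
    where open ≡-Reasoning

  +-congˡ-≋ : ∀ {x y} z → x ≋ y → z + x ≋ z + y
  +-congˡ-≋ {x} {y} z e rewrite +-comm z x | +-comm z y = +-congʳ-≋ z e

  +n-≋ : ∀ x → x + n ≋ x
  +n-≋ x = mk≋ ([m+n]%n≡m%n x n)

  +-inverse-≋ : ∀ x z → x + z + (n ∸ z % n) ≋ x
  +-inverse-≋ x z = ≋-trans (+-congʳ-≋ (n ∸ z % n) (+-congˡ-≋ x (mk≋ (sym (m%n%n≡m%n z n)))))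
                            (≋-trans (≡⇒≋ x+z%n+[n∸z%n]≡x+n) (+n-≋ x))
    where
    x+z%n+[n∸z%n]≡x+n : x + z % n + (n ∸ z % n) ≡ x + n
    x+z%n+[n∸z%n]≡x+n = trans (+-assoc x (z % n) _) (cong (x +_) (m+[n∸m]≡n (<⇒≤ (m%n<n z n))))

  +-cancelʳ-≋ : ∀ {x y} z → x + z ≋ y + z → x ≋ y
  +-cancelʳ-≋ {x} {y} z e = ≋-trans (≋-sym (+-inverse-≋ x z)) (≋-trans (+-congʳ-≋ (n ∸ z % n) e) (+-inverse-≋ y z))

  ≋⇒≡ : ∀ {x y} → x < n → y < n → x ≋ y → x ≡ y
  ≋⇒≡ x<n y<n (mk≋ e) = trans (sym (m<n⇒m%n≡m x<n)) (trans e (m<n⇒m%n≡m y<n))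

  ≋⇒≡⊎≡+n : ∀ {x y} → x < n + n → y < n → x ≋ y → x ≡ y ⊎ x ≡ y + n
  ≋⇒≡⊎≡+n {x} x<2n y<n x≋y with x <? n
  ... | yes x<n = inj₁ (≋⇒≡ x<n y<n x≋y)
  ... | no x≮n with m≤n⇒∃[o]m+o≡n (≮⇒≥ x≮n)
  ...   | r , refl = inj₂ (trans (+-comm n r) (cong (_+ n) r≡y))
    where
    r≡y = ≋⇒≡ (+-cancelˡ-< n r n x<2n) y<n (≋-trans (≋-sym (+n-≋ r)) (≋-trans (≡⇒≋ (+-comm r n)) x≋y))

  Apart : Bool → ℕ → ℕ → ℕ → Set
  Apart true  a i j = a + j ≋ i
  Apart false a i j = a + i ≋ j

  apart-complement : ∀ d {a i j} → a ≤ n → Apart d a i j → Apart (not d) (n ∸ a) i j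
  apart-complement d {a} {i} {j} a≤n ap = go d ap
    where
    wrap : ∀ x → n ∸ a + (x + a) ≋ x
    wrap x = ≋-trans (≡⇒≋ (trans (solve 3 (λ y x a → y :+ (x :+ a) := x :+ (a :+ y)) refl (n ∸ a) x a)
                                  (cong (x +_) (m+[n∸m]≡n a≤n)))) (+n-≋ x)
    go : ∀ d → Apart d a i j → Apart (not d) (n ∸ a) i j
    go true  ap = ≋-trans (+-congˡ-≋ (n ∸ a) (≋-trans (≋-sym ap) (≡⇒≋ (+-comm a j)))) (wrap j)
    go false ap = ≋-trans (+-congˡ-≋ (n ∸ a) (≋-trans (≋-sym ap) (≡⇒≋ (+-comm a i)))) (wrap i)

  apart-%n : ∀ d {a i j} → Apart d a i j → Apart d (a % n) i j
  apart-%n true  {a} {i} {j} ap = ≋-trans (+-congʳ-≋ j (mk≋ (m%n%n≡m%n a n))) ap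
  apart-%n false {a} {i} {j} ap = ≋-trans (+-congʳ-≋ i (mk≋ (m%n%n≡m%n a n))) ap

  apart-zero : ∀ d {i j} → i < n → j < n → Apart d 0 i j → i ≡ j
  apart-zero true  i<n j<n ap = sym (≋⇒≡ j<n i<n ap)
  apart-zero false i<n j<n ap = ≋⇒≡ i<n j<n ap

  apart-n : ∀ d {i j} → i < n → j < n → Apart d n i j → i ≡ j
  apart-n true  {i} {j} i<n j<n ap = sym (≋⇒≡ j<n i<n (≋-trans (≋-sym (+n-≋ j)) (≋-trans (≡⇒≋ (+-comm j n)) ap)))
  apart-n false {i} {j} i<n j<n ap = ≋⇒≡ i<n j<n (≋-trans (≋-sym (+n-≋ i)) (≋-trans (≡⇒≋ (+-comm i n)) ap))

  ∣-∣-cases : ∀ i j → (∃ λ e → i ≡ j + e × ∣ i - j ∣ ≡ e) ⊎ (∃ λ e → j ≡ i + e × ∣ i - j ∣ ≡ e)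
  ∣-∣-cases i j with ≤-total j i
  ... | inj₁ j≤i with m≤n⇒∃[o]m+o≡n j≤i
  ...   | e , refl = inj₁ (e , refl , trans (∣-∣-comm (j + e) j) (∣m-m+n∣≡n j e))
  ∣-∣-cases i j | inj₂ i≤j with m≤n⇒∃[o]m+o≡n i≤j
  ...   | e , refl = inj₂ (e , refl , ∣m-m+n∣≡n i e)

  apart-small : ∀ d {a i j} → a < n → i < n → j < n → Apart d a i j → a ≡ ∣ i - j ∣ ⊎ a + ∣ i - j ∣ ≡ n
  apart-small true  {a} {i} {j} a<n i<n j<n ap with ≋⇒≡⊎≡+n (+-mono-< a<n j<n) i<n ap | ∣-∣-cases i j
  ... | inj₁ a+j≡i | inj₁ (e , refl , ∣i-j∣≡e) rewrite ∣i-j∣≡e =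
    inj₁ (+-cancelʳ-≡ j a e (trans a+j≡i (+-comm j e)))
  ... | inj₁ a+j≡i | inj₂ (e , refl , ∣i-j∣≡e) rewrite ∣i-j∣≡e =
    inj₁ (trans (m+n≡0⇒m≡0 a a+e≡0) (sym (m+n≡0⇒n≡0 a a+e≡0)))
    where
    a+e≡0 : a + e ≡ 0
    a+e≡0 = +-cancelˡ-≡ i (a + e) 0 (trans (solve 3 (λ i a e → i :+ (a :+ e) := a :+ (i :+ e)) refl i a e)
                                           (trans a+j≡i (sym (+-identityʳ i))))
  ... | inj₂ a+j≡i+n | inj₁ (e , refl , _) = ⊥-elim (<⇒≱ a<n (subst (n ≤_) e+n≡a (m≤n+m n e)))
    where
    e+n≡a : e + n ≡ a
    e+n≡a = +-cancelˡ-≡ j (e + n) a (trans (sym (+-assoc j e n)) (trans (sym a+j≡i+n) (+-comm a j)))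
  ... | inj₂ a+j≡i+n | inj₂ (e , refl , ∣i-j∣≡e) rewrite ∣i-j∣≡e =
    inj₂ (+-cancelˡ-≡ i (a + e) n (trans (solve 3 (λ i a e → i :+ (a :+ e) := a :+ (i :+ e)) refl i a e) a+j≡i+n))
  apart-small false {a} {i} {j} a<n i<n j<n ap rewrite ∣-∣-comm i j = apart-small true a<n j<n i<n ap

  -- For i j < n this is the distance between (b , i) and (c , j) in GP(n,2) (Distance.dist≡δ).
  circDist : Bool → Bool → ℕ → ℕ → ℕ
  circDist b c i j = ladder b c ∣ i - j ∣ ⊓ ladder b c (n ∸ ∣ i - j ∣)

  circDist-attained : ∀ b c {i j} → i < n → j < n → ∃ λ d → ∃ λ a → Apart d a i j × circDist b c i j ≡ ladder b c a
  circDist-attained b c {i} {j} i<n j<n with ∣-∣-cases i j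
  ... | inj₁ (e , refl , ∣i-j∣≡e) rewrite ∣i-j∣≡e with ⊓-sel (ladder b c e) (ladder b c (n ∸ e))
  ...   | inj₁ eq = true  , e , ≡⇒≋ (+-comm e j) , eq
  ...   | inj₂ eq = false , n ∸ e , apart-complement true (≤-trans (m≤n+m e j) (<⇒≤ i<n)) (≡⇒≋ (+-comm e j)) , eq
  circDist-attained b c {i} {j} i<n j<n | inj₂ (e , refl , ∣i-j∣≡e) rewrite ∣i-j∣≡e with ⊓-sel (ladder b c e) (ladder b c (n ∸ e))
  ...   | inj₁ eq = false , e , ≡⇒≋ (+-comm e i) , eq
  ...   | inj₂ eq = true  , n ∸ e , apart-complement false (≤-trans (m≤n+m e i) (<⇒≤ j<n)) (≡⇒≋ (+-comm e i)) , eq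

  circDist-apart : ∀ b c d {a i j} → a ≤ n → i < n → j < n → Apart d a i j →
                   circDist b c i j ≡ ladder b c a ⊓ ladder b c (n ∸ a)
  circDist-apart b c d {a} {i} {j} a≤n i<n j<n ap with m≤n⇒m<n∨m≡n a≤n
  ... | inj₂ refl rewrite apart-n d i<n j<n ap | ∣n-n∣≡0 j | n∸n≡0 n = ⊓-comm _ _
  ... | inj₁ a<n with apart-small d a<n i<n j<n ap
  ...   | inj₁ refl = refl
  ...   | inj₂ a+∣i-j∣≡n = trans (cong₂ (λ x y → ladder b c x ⊓ ladder b c y) n∸a≡∣i-j∣ n∸∣i-j∣≡a) (⊓-comm _ _)
    where
    n∸a≡∣i-j∣ = sym (trans (cong (_∸ a) (sym a+∣i-j∣≡n)) (m+n∸m≡n a _))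
    n∸∣i-j∣≡a = trans (cong (_∸ ∣ i - j ∣) (sym a+∣i-j∣≡n)) (m+n∸n≡m a ∣ i - j ∣)

  %n+n≤ : ∀ {a} → n ≤ a → a % n + n ≤ a
  %n+n≤ {a} n≤a = begin
    a % n + n       ≡⟨ cong (_+ n) (m≤n⇒[n∸m]%m≡n%m n≤a) ⟨
    (a ∸ n) % n + n ≤⟨ +-monoˡ-≤ n (m%n≤m (a ∸ n) n) ⟩
    a ∸ n + n       ≡⟨ m∸n+n≡m n≤a ⟩
    a               ∎
    where open ≤-Reasoning

  circDist-≤-ladder : 5 ≤ n → ∀ b c d {a i j} → i < n → j < n → Apart d a i j → circDist b c i j ≤ ladder b c a
  circDist-≤-ladder 5≤n b c d {a} {i} {j} i<n j<n ap = ≤-trans below-n reduce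
    where
    below-n : circDist b c i j ≤ ladder b c (a % n)
    below-n with apart-small d (m%n<n a n) i<n j<n (apart-%n d ap)
    ... | inj₁ a%n≡∣i-j∣ rewrite a%n≡∣i-j∣ = m⊓n≤m _ _
    ... | inj₂ a%n+∣i-j∣≡n =
      ≤-trans (m⊓n≤n _ _)
              (≤-reflexive (cong (ladder b c) (trans (cong (_∸ ∣ i - j ∣) (sym a%n+∣i-j∣≡n)) (m+n∸n≡m (a % n) ∣ i - j ∣))))
    reduce : ladder b c (a % n) ≤ ladder b c a
    reduce with a <? n
    ... | yes a<n = ≤-reflexive (cong (ladder b c) (m<n⇒m%n≡m a<n))
    ... | no a≮n  = ladder-mono-≤₅ b c (≤-trans (≤-reflexive (+-comm 5 (a % n)))
                                                (≤-trans (+-monoʳ-≤ (a % n) 5≤n) (%n+n≤ (≮⇒≥ a≮n))))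

  away-ahead : ∀ {a k i i′ j} → Apart true a i j → i + k ≋ i′ → Apart true (k + a) i′ j
  away-ahead {a} {k} {i} {i′} {j} ap fwd =
    ≋-trans (≡⇒≋ (+-assoc k a j)) (≋-trans (+-congˡ-≋ k ap) (≋-trans (≡⇒≋ (+-comm k i)) fwd))

  away-behind : ∀ {a k i i′ j} → Apart false a i j → i′ + k ≋ i → Apart false (k + a) i′ j
  away-behind {a} {k} {i} {i′} {j} ap bwd =
    ≋-trans (≡⇒≋ (solve 3 (λ k a x → k :+ a :+ x := a :+ (x :+ k)) refl k a i′)) (≋-trans (+-congˡ-≋ a bwd) ap)

  toward-ahead : ∀ {a k q i i′ j} → Apart true a i j → i′ + k ≋ i → k + q ≡ a → Apart true q i′ j
  toward-ahead {k = k} {q} {i} {i′} {j} ap bwd refl =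
    +-cancelʳ-≋ k (≋-trans (≡⇒≋ (solve 3 (λ q j k → q :+ j :+ k := k :+ q :+ j) refl q j k)) (≋-trans ap (≋-sym bwd)))

  past-ahead : ∀ {a k q i i′ j} → Apart true a i j → i′ + k ≋ i → a + q ≡ k → Apart false q i′ j
  past-ahead {a} {k} {q} {i} {i′} {j} ap bwd refl =
    +-cancelʳ-≋ a (≋-trans (≡⇒≋ (solve 3 (λ q x a → q :+ x :+ a := x :+ (a :+ q)) refl q i′ a))
                           (≋-trans bwd (≋-trans (≋-sym ap) (≡⇒≋ (+-comm a j)))))

  toward-behind : ∀ {a k q i i′ j} → Apart false a i j → i + k ≋ i′ → k + q ≡ a → Apart false q i′ j
  toward-behind {k = k} {q} {i} {i′} {j} ap fwd refl =
    ≋-trans (+-congˡ-≋ q (≋-sym fwd)) (≋-trans (≡⇒≋ (solve 3 (λ q i k → q :+ (i :+ k) := k :+ q :+ i) refl q i k)) ap)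

  past-behind : ∀ {a k q i i′ j} → Apart false a i j → i + k ≋ i′ → a + q ≡ k → Apart true q i′ j
  past-behind {a} {k} {q} {i} {i′} {j} ap fwd refl =
    ≋-trans (+-congˡ-≋ q (≋-sym ap)) (≋-trans (≡⇒≋ (solve 3 (λ q a i → q :+ (a :+ i) := i :+ (a :+ q)) refl q a i)) fwd)

  apart-step : ∀ d {a k i i′ j} → Apart d a i j → i + k ≋ i′ ⊎ i′ + k ≋ i →
               ∃ λ d′ → ∃ λ a′ → Apart d′ a′ i′ j × OffsetStep k a a′
  apart-step true  ap (inj₁ fwd) = true  , _ , away-ahead  ap fwd , inj₂ (inj₁ refl)
  apart-step false {i′ = i′} ap (inj₂ bwd) = false , _ , away-behind {i′ = i′} ap bwd , inj₂ (inj₁ refl)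
  apart-step true {a} {k} ap (inj₂ bwd) with ≤-total k a
  ... | inj₁ k≤a = true  , a ∸ k , toward-ahead ap bwd (m+[n∸m]≡n k≤a) , inj₁ (m+[n∸m]≡n k≤a)
  ... | inj₂ a≤k = false , k ∸ a , past-ahead   ap bwd (m+[n∸m]≡n a≤k) , inj₂ (inj₂ (inj₁ (m+[n∸m]≡n a≤k)))
  apart-step false {a} {k} ap (inj₁ fwd) with ≤-total k a
  ... | inj₁ k≤a = false , a ∸ k , toward-behind ap fwd (m+[n∸m]≡n k≤a) , inj₁ (m+[n∸m]≡n k≤a)
  ... | inj₂ a≤k = true  , k ∸ a , past-behind   ap fwd (m+[n∸m]≡n a≤k) , inj₂ (inj₂ (inj₁ (m+[n∸m]≡n a≤k)))

  apart-trans : ∀ d₁ d₂ {a₁ a₂ i k j} → Apart d₁ a₁ i k → Apart d₂ a₂ k j →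
                ∃ λ d → ∃ λ a → Apart d a i j × a ≤ a₁ + a₂
  apart-trans true true {a₁} {a₂} {i} {k} {j} ap₁ ap₂ =
    true , a₁ + a₂ , ≋-trans (≡⇒≋ (+-assoc a₁ a₂ j)) (≋-trans (+-congˡ-≋ a₁ ap₂) ap₁) , ≤-refl
  apart-trans false false {a₁} {a₂} {i} {k} {j} ap₁ ap₂ =
    false , a₁ + a₂ ,
    ≋-trans (≡⇒≋ (solve 3 (λ a b i → a :+ b :+ i := b :+ (a :+ i)) refl a₁ a₂ i)) (≋-trans (+-congˡ-≋ a₂ ap₁) ap₂) , ≤-refl
  apart-trans true false {a₁} {a₂} {i} {k} {j} ap₁ ap₂ with ≤-total a₂ a₁
  ... | inj₁ a₂≤a₁ = true , a₁ ∸ a₂ ,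
    ≋-trans (+-congˡ-≋ (a₁ ∸ a₂) (≋-sym ap₂))
            (≋-trans (≡⇒≋ (trans (sym (+-assoc (a₁ ∸ a₂) a₂ k)) (cong (_+ k) (m∸n+n≡m a₂≤a₁)))) ap₁) ,
    ≤-trans (m∸n≤m a₁ a₂) (m≤m+n a₁ a₂)
  ... | inj₂ a₁≤a₂ = false , a₂ ∸ a₁ ,
    ≋-trans (+-congˡ-≋ (a₂ ∸ a₁) (≋-sym ap₁))
            (≋-trans (≡⇒≋ (trans (sym (+-assoc (a₂ ∸ a₁) a₁ k)) (cong (_+ k) (m∸n+n≡m a₁≤a₂)))) ap₂) ,
    ≤-trans (m∸n≤m a₂ a₁) (m≤n+m a₂ a₁)
  apart-trans false true {a₁} {a₂} {i} {k} {j} ap₁ ap₂ with ≤-total a₂ a₁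
  ... | inj₁ a₂≤a₁ = false , a₁ ∸ a₂ ,
    +-cancelʳ-≋ a₂ (≋-trans (≡⇒≋ (trans (solve 3 (λ d i b → d :+ i :+ b := d :+ b :+ i) refl (a₁ ∸ a₂) i a₂)
                                        (cong (_+ i) (m∸n+n≡m a₂≤a₁))))
                            (≋-trans ap₁ (≋-trans (≋-sym ap₂) (≡⇒≋ (+-comm a₂ j))))) ,
    ≤-trans (m∸n≤m a₁ a₂) (m≤m+n a₁ a₂)
  ... | inj₂ a₁≤a₂ = true , a₂ ∸ a₁ ,
    +-cancelʳ-≋ a₁ (≋-trans (≡⇒≋ (trans (solve 3 (λ d j a → d :+ j :+ a := d :+ a :+ j) refl (a₂ ∸ a₁) j a₁)
                                        (cong (_+ j) (m∸n+n≡m a₁≤a₂))))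
                            (≋-trans ap₂ (≋-trans (≋-sym ap₁) (≡⇒≋ (+-comm a₁ i))))) ,
    ≤-trans (m∸n≤m a₂ a₁) (m≤n+m a₂ a₁)

module Distance (n : ℕ) {{_ : NonZero n}} (5≤n : 5 ≤ n) where

  open Circular n

  δ : Vtx n → Vtx n → ℕ
  δ (b , i) (c , j) = circDist b c (toℕ i) (toℕ j)

  δ-self : ∀ x → δ x x ≡ 0
  δ-self (true  , i) rewrite ∣n-n∣≡0 (toℕ i) = refl
  δ-self (false , i) rewrite ∣n-n∣≡0 (toℕ i) = refl

  δ-≤-ladder : ∀ b c d {a} (i j : Fin n) → Apart d a (toℕ i) (toℕ j) → δ (b , i) (c , j) ≤ ladder b c a
  δ-≤-ladder b c d i j = circDist-≤-ladder 5≤n b c d (toℕ<n i) (toℕ<n j)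

  %≡⇒≋ : ∀ {x} (i : Fin n) → x % n ≡ toℕ i → x ≋ toℕ i
  %≡⇒≋ i e = mk≋ (trans e (sym (m<n⇒m%n≡m (toℕ<n i))))

  step⇒≋ : ∀ {k} {i i′ : Fin n} → step n k i i′ → toℕ i + k ≋ toℕ i′ ⊎ toℕ i′ + k ≋ toℕ i
  step⇒≋ {i = i} {i′} (inj₁ e) = inj₁ (%≡⇒≋ i′ e)
  step⇒≋ {i = i} {i′} (inj₂ e) = inj₂ (%≡⇒≋ i e)

  Adj-sym : ∀ x y → Adj n x y → Adj n y x
  Adj-sym (true  , _) (true  , _) (inj₁ e) = inj₂ e
  Adj-sym (true  , _) (true  , _) (inj₂ e) = inj₁ e
  Adj-sym (false , _) (false , _) (inj₁ e) = inj₂ e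
  Adj-sym (false , _) (false , _) (inj₂ e) = inj₁ e
  Adj-sym (true  , _) (false , _) e        = sym e
  Adj-sym (false , _) (true  , _) e        = sym e

  adj-apart-step : ∀ b (i : Fin n) b′ (i′ : Fin n) → Adj n (b , i) (b′ , i′) → ∀ d {a} (j : Fin n) →
                   Apart d a (toℕ i) (toℕ j) →
                   ∃ λ d′ → ∃ λ a′ → Apart d′ a′ (toℕ i′) (toℕ j) × OffsetStep (stepLength b b′) a a′
  adj-apart-step true  i true  i′ adj d j ap = apart-step d ap (step⇒≋ adj)
  adj-apart-step false i false i′ adj d j ap = apart-step d ap (step⇒≋ adj)
  adj-apart-step true  i false i  refl d j ap = d , _ , ap , inj₂ (inj₂ (inj₂ refl))
  adj-apart-step false i true  i  refl d j ap = d , _ , ap , inj₂ (inj₂ (inj₂ refl))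

  δ-adj-≤ : ∀ x y → Adj n x y → ∀ t → δ y t ≤ suc (δ x t)
  δ-adj-≤ (b , i) (b′ , i′) adj (c , j) with circDist-attained b c (toℕ<n i) (toℕ<n j)
  ... | d , a , ap , δ≡ with adj-apart-step b i b′ i′ adj d j ap
  ...   | d′ , a′ , ap′ , offsetStep = begin
    δ (b′ , i′) (c , j)  ≤⟨ δ-≤-ladder b′ c d′ i′ j ap′ ⟩
    ladder b′ c a′       ≤⟨ ladder-lipschitz b b′ c offsetStep ⟩
    suc (ladder b c a)   ≡⟨ cong suc δ≡ ⟨
    suc (δ (b , i) (c , j)) ∎
    where open ≤-Reasoning

  δ-adj-≥ : ∀ x y → Adj n x y → ∀ t → δ x t ≤ suc (δ y t)
  δ-adj-≥ x y adj = δ-adj-≤ y x (Adj-sym x y adj)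

  fin% : ℕ → Fin n
  fin% x = fromℕ< (m%n<n x n)

  toℕ-fin% : ∀ x → toℕ (fin% x) ≡ x % n
  toℕ-fin% x = toℕ-fromℕ< (m%n<n x n)

  stepLength-≤ : ∀ b → stepLength b b ≤ n
  stepLength-≤ true  = ≤-trans (s≤s z≤n) 5≤n
  stepLength-≤ false = ≤-trans (s≤s (s≤s z≤n)) 5≤n

  -- The rim neighbour of (b , i) one step closer to j, when Apart d a (toℕ i) (toℕ j).
  toward : Bool → Fin n → Bool → Fin n
  toward b i true  = fin% (toℕ i + (n ∸ stepLength b b))
  toward b i false = fin% (toℕ i + stepLength b b)

  toward-true-step : ∀ b (i : Fin n) → (toℕ (toward b i true) + stepLength b b) % n ≡ toℕ i
  toward-true-step b i = begin
    (toℕ (fin% (toℕ i + (n ∸ k))) + k) % n ≡⟨ cong (λ w → (w + k) % n) (toℕ-fin% (toℕ i + (n ∸ k))) ⟩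
    ((toℕ i + (n ∸ k)) % n + k) % n        ≡⟨ ≋⇒%≡ (+-congʳ-≋ k (mk≋ (m%n%n≡m%n (toℕ i + (n ∸ k)) n))) ⟩
    (toℕ i + (n ∸ k) + k) % n              ≡⟨ cong (_% n) (trans (+-assoc (toℕ i) (n ∸ k) k)
                                                                 (cong (toℕ i +_) (m∸n+n≡m (stepLength-≤ b)))) ⟩
    (toℕ i + n) % n                        ≡⟨ [m+n]%n≡m%n (toℕ i) n ⟩
    toℕ i % n                              ≡⟨ m<n⇒m%n≡m (toℕ<n i) ⟩
    toℕ i                                  ∎
    where
    open ≡-Reasoning
    k = stepLength b b

  toward-adj : ∀ b (i : Fin n) d → Adj n (b , i) (b , toward b i d)
  toward-adj true  i true  = inj₂ (toward-true-step true i)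
  toward-adj false i true  = inj₂ (toward-true-step false i)
  toward-adj true  i false = inj₁ (sym (toℕ-fin% (toℕ i + 1)))
  toward-adj false i false = inj₁ (sym (toℕ-fin% (toℕ i + 2)))

  toward-apart : ∀ b d {a q} (i j : Fin n) → stepLength b b + q ≡ a → Apart d a (toℕ i) (toℕ j) →
                 Apart d q (toℕ (toward b i d)) (toℕ j)
  toward-apart b true  i j k+q≡a ap = toward-ahead ap (%≡⇒≋ i (toward-true-step b i)) k+q≡a
  toward-apart b false i j k+q≡a ap =
    toward-behind ap (%≡⇒≋ (toward b i false) (sym (toℕ-fin% (toℕ i + stepLength b b)))) k+q≡a

  descent-neighbour : ∀ b b′ d {a q} (i j : Fin n) → stepLength b b′ + q ≡ a → Apart d a (toℕ i) (toℕ j) →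
                      ∃ λ i′ → Adj n (b , i) (b′ , i′) × Apart d q (toℕ i′) (toℕ j)
  descent-neighbour true  true  d i j k+q≡a ap = toward true  i d , toward-adj true  i d , toward-apart true  d i j k+q≡a ap
  descent-neighbour false false d i j k+q≡a ap = toward false i d , toward-adj false i d , toward-apart false d i j k+q≡a ap
  descent-neighbour true  false d i j refl  ap = i , refl , ap
  descent-neighbour false true  d i j refl  ap = i , refl , ap

  δ-descent : ∀ x t {r} → δ x t ≡ suc r → ∃ λ y → Adj n x y × δ y t ≤ r
  δ-descent (b , i) (c , j) δ≡1+r with circDist-attained b c (toℕ<n i) (toℕ<n j)
  ... | d , a , ap , δ≡ladder with ladder-descent b c a (subst (0 <_) (trans (sym δ≡1+r) δ≡ladder) z<s)
  ...   | b′ , q , k+q≡a , closer with descent-neighbour b b′ d i j k+q≡a ap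
  ...     | i′ , adj , ap′ = (b′ , i′) , adj , ≤-pred (begin-strict
    δ (b′ , i′) (c , j) ≤⟨ δ-≤-ladder b′ c d i′ j ap′ ⟩
    ladder b′ c q       <⟨ closer ⟩
    ladder b c a        ≡⟨ trans (sym δ≡ladder) δ≡1+r ⟩
    suc _               ∎)
    where open ≤-Reasoning

  δ≡0⇒≡ : ∀ s t → δ s t ≡ 0 → s ≡ t
  δ≡0⇒≡ (b , i) (c , j) δ≡0 with circDist-attained b c (toℕ<n i) (toℕ<n j)
  ... | d , a , ap , δ≡ladder with ladder≡0 b c a (trans (sym δ≡ladder) δ≡0)
  ...   | refl , refl = cong (b ,_) (toℕ-injective (apart-zero d (toℕ<n i) (toℕ<n j) ap))

  ∈-allVtx : ∀ x → x ∈ allVtx n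
  ∈-allVtx (true  , i) = ∈-++⁺ˡ (∈-map⁺ (true ,_) (∈-allFin i))
  ∈-allVtx (false , i) = ∈-++⁺ʳ (map (true ,_) (allFin n)) (∈-map⁺ (false ,_) (∈-allFin i))

  ∈-neighbours⁻ : ∀ s {y} → y ∈ neighbours n s → Adj n s y
  ∈-neighbours⁻ s y∈ = proj₂ (∈-filter⁻ (Adj? n s) {xs = allVtx n} y∈)

  ∈-neighbours⁺ : ∀ {s y} → Adj n s y → y ∈ neighbours n s
  ∈-neighbours⁺ {s} {y} adj = ∈-filter⁺ (Adj? n s) (∈-allVtx y) adj

  ∈-walks-zero⁻ : ∀ s t {p} → p ∈ walks n 0 s t → s ≡ t × p ≡ s ∷ []
  ∈-walks-zero⁻ s t p∈ with s ≟V t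
  ∈-walks-zero⁻ s t (here refl) | yes s≡t = s≡t , refl

  ∈-walks-zero⁺ : ∀ {s} → (s ∷ []) ∈ walks n 0 s s
  ∈-walks-zero⁺ {s} with s ≟V s
  ... | yes _   = here refl
  ... | no s≢s = ⊥-elim (s≢s refl)

  ∈-walks-suc⁻ : ∀ k s t {p} → p ∈ walks n (suc k) s t →
                 ∃ λ y → ∃ λ p′ → Adj n s y × p ≡ s ∷ p′ × p′ ∈ walks n k y t
  ∈-walks-suc⁻ k s t p∈ with find (∈-concatMap⁻ (λ w → map (s ∷_) (walks n k w t)) {xs = neighbours n s} p∈)
  ... | y , y∈ , p∈′ with ∈-map⁻ (s ∷_) p∈′
  ...   | p′ , p′∈ , refl = y , p′ , ∈-neighbours⁻ s y∈ , refl , p′∈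

  ∈-walks-suc⁺ : ∀ {k s t y p′} → Adj n s y → p′ ∈ walks n k y t → (s ∷ p′) ∈ walks n (suc k) s t
  ∈-walks-suc⁺ {k} {s} {t} adj p′∈ =
    ∈-concatMap⁺ (λ w → map (s ∷_) (walks n k w t)) {xs = neighbours n s} (lose (∈-neighbours⁺ adj) (∈-map⁺ (s ∷_) p′∈))

  walk-length-≥ : ∀ k s t {p} → p ∈ walks n k s t → δ s t ≤ k
  walk-length-≥ zero s t p∈ with ∈-walks-zero⁻ s t p∈
  ... | refl , _ = ≤-reflexive (δ-self s)
  walk-length-≥ (suc k) s t p∈ with ∈-walks-suc⁻ k s t p∈
  ... | y , p′ , adj , refl , p′∈ = ≤-trans (δ-adj-≥ s y adj t) (s≤s (walk-length-≥ k y t p′∈))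

  walk-through-≥ : ∀ k s t {p} x → p ∈ walks n k s t → x ∈ p → δ s x + δ x t ≤ k
  walk-through-≥ zero s t x p∈ x∈ with ∈-walks-zero⁻ s t p∈
  walk-through-≥ zero s t x p∈ (here refl) | refl , refl rewrite δ-self s = ≤-refl
  walk-through-≥ (suc k) s t x p∈ x∈ with ∈-walks-suc⁻ k s t p∈
  walk-through-≥ (suc k) s t x p∈ (here refl)  | y , p′ , adj , refl , p′∈ rewrite δ-self s = walk-length-≥ (suc k) s t p∈
  walk-through-≥ (suc k) s t x p∈ (there x∈p′) | y , p′ , adj , refl , p′∈ =
    ≤-trans (+-monoˡ-≤ (δ x t) (δ-adj-≥ s y adj x)) (s≤s (walk-through-≥ k y t x p′∈ x∈p′))

  walk-exists : ∀ k s t → δ s t ≡ k → ∃ λ p → p ∈ walks n k s t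
  walk-exists zero s t δ≡0 with δ≡0⇒≡ s t δ≡0
  ... | refl = (s ∷ []) , ∈-walks-zero⁺
  walk-exists (suc k) s t δ≡1+k with δ-descent s t δ≡1+k
  ... | y , adj , δy≤k with walk-exists k y t (≤-antisym δy≤k (≤-pred (subst (_≤ suc (δ y t)) δ≡1+k (δ-adj-≥ s y adj t))))
  ...   | p , p∈ = (s ∷ p) , ∈-walks-suc⁺ {k} {t = t} adj p∈

  distSearch-≡δ : ∀ s t k fuel → k ≤ δ s t → δ s t ≤ k + fuel → distSearch n s t k fuel ≡ δ s t
  distSearch-≡δ s t k zero       k≤δ δ≤k+0 = ≤-antisym k≤δ (subst (δ s t ≤_) (+-identityʳ k) δ≤k+0)
  distSearch-≡δ s t k (suc fuel) k≤δ δ≤k+1+fuel with m≤n⇒m<n∨m≡n k≤δ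
  ... | inj₂ refl rewrite null-∈ (proj₂ (walk-exists k s t refl)) = refl
  ... | inj₁ k<δ rewrite null-∉ (walks n k s t) (λ p∈ → <⇒≱ k<δ (walk-length-≥ k s t p∈)) =
    distSearch-≡δ s t (suc k) fuel k<δ (subst (δ s t ≤_) (+-suc k fuel) δ≤k+1+fuel)

  δ≤2n : ∀ s t → δ s t ≤ 2 * n
  δ≤2n (b , i) (c , j) = begin
    δ (b , i) (c , j)          ≤⟨ m⊓n≤m _ _ ⟩
    ladder b c ∣ i′ - j′ ∣     ≤⟨ ladder-≤ b c _ ⟩
    3 + ∣ i′ - j′ ∣            ≤⟨ +-monoʳ-≤ 3 (≤-trans (∣m-n∣≤m⊔n i′ j′) (<⇒≤ (⊔-lub (toℕ<n i) (toℕ<n j)))) ⟩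
    3 + n                      ≤⟨ +-monoˡ-≤ n (≤-trans (s≤s (s≤s (s≤s z≤n))) 5≤n) ⟩
    n + n                      ≡⟨ cong (n +_) (+-identityʳ n) ⟨
    2 * n                      ∎
    where
    open ≤-Reasoning
    i′ = toℕ i
    j′ = toℕ j

  dist≡δ : ∀ s t → dist n s t ≡ δ s t
  dist≡δ s t = distSearch-≡δ s t 0 (2 * n) z≤n (δ≤2n s t)

  δ-arcs : ∀ b c d {a} X (i j : Fin n) → n ≡ X + a → Apart d a (toℕ i) (toℕ j) →
           δ (b , i) (c , j) ≡ ladder b c a ⊓ ladder b c X
  δ-arcs b c d {a} X i j n≡X+a ap =
    trans (circDist-apart b c d (subst (a ≤_) (sym n≡X+a) (m≤n+m a X)) (toℕ<n i) (toℕ<n j) ap)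
          (cong (λ w → ladder b c a ⊓ ladder b c w) (trans (cong (_∸ a) n≡X+a) (m+n∸n≡m X a)))

  rim-neighbour : ∀ b d {a} (c c′ j : Fin n) → Apart d a (toℕ c) (toℕ j) → step n (stepLength b b) c c′ →
                  c′ ≡ toward b c d ⊎ Apart d (stepLength b b + a) (toℕ c′) (toℕ j)
  rim-neighbour b true c c′ j ap st with step⇒≋ st
  ... | inj₁ fwd = inj₂ (away-ahead ap fwd)
  ... | inj₂ bwd = inj₁ (toℕ-injective (≋⇒≡ (toℕ<n c′) (toℕ<n _)
                          (+-cancelʳ-≋ (stepLength b b) (≋-trans bwd (≋-sym (%≡⇒≋ c (toward-true-step b c)))))))
  rim-neighbour b false c c′ j ap st with step⇒≋ st
  ... | inj₂ bwd = inj₂ (away-behind {k = stepLength b b} {i′ = toℕ c′} ap bwd)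
  ... | inj₁ fwd = inj₁ (toℕ-injective (≋⇒≡ (toℕ<n c′) (toℕ<n _)
                          (≋-trans (≋-sym fwd) (%≡⇒≋ (toward b c false) (sym (toℕ-fin% (toℕ c + stepLength b b)))))))

module PathCounting (n : ℕ) {{_ : NonZero n}} (5≤n : 5 ≤ n) where

  open Circular n
  open Distance n 5≤n

  allVtx-unique : Unique (allVtx n)
  allVtx-unique = Unique.++⁺ (Unique.map⁺ (λ { refl → refl }) (Unique.allFin⁺ n))
                             (Unique.map⁺ (λ { refl → refl }) (Unique.allFin⁺ n)) rims-disjoint
    where
    rims-disjoint : ∀ {x} → ¬ (x ∈ map (true ,_) (allFin n) × x ∈ map (false ,_) (allFin n))
    rims-disjoint (x∈outer , x∈inner) with ∈-map⁻ (true ,_) x∈outer | ∈-map⁻ (false ,_) x∈inner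
    ... | _ , _ , refl | _ , _ , ()

  neighbours-unique : ∀ s → Unique (neighbours n s)
  neighbours-unique s = Unique.filter⁺ (Adj? n s) allVtx-unique

  σ≡walks : ∀ s t → σ n s t ≡ length (walks n (δ s t) s t)
  σ≡walks s t = cong (λ k → length (walks n k s t)) (dist≡δ s t)

  σvia≡walks : ∀ s t x → σvia n s t x ≡ length (filter (x ∈?_) (walks n (δ s t) s t))
  σvia≡walks s t x = cong (λ k → length (filter (x ∈?_) (walks n k s t))) (dist≡δ s t)

  σ-self : ∀ s → σ n s s ≡ 1
  σ-self s rewrite σ≡walks s s | δ-self s with s ≟V s
  ... | yes _   = refl
  ... | no s≢s = ⊥-elim (s≢s refl)

  σ-positive : ∀ s t → 0 < σ n s t
  σ-positive s t rewrite σ≡walks s t = length-∈ (proj₂ (walk-exists (δ s t) s t refl))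

  walks-geodesic : ∀ k y t → δ y t ≡ k → length (walks n k y t) ≡ σ n y t
  walks-geodesic k y t refl = sym (σ≡walks y t)

  walks-too-short : ∀ k y t → k < δ y t → length (walks n k y t) ≡ 0
  walks-too-short k y t k<δ = length-∉ _ (λ p∈ → <⇒≱ k<δ (walk-length-≥ k y t p∈))

  walk-head : ∀ k s t {p} → p ∈ walks n k s t → s ∈ p
  walk-head zero s t p∈ with ∈-walks-zero⁻ s t p∈
  ... | _ , refl = here refl
  walk-head (suc k) s t p∈ with ∈-walks-suc⁻ k s t p∈
  ... | _ , _ , _ , refl , _ = here refl

  walks-through-head : ∀ k x t → length (filter (x ∈?_) (walks n k x t)) ≡ length (walks n k x t)
  walks-through-head k x t = cong length (filter-all (x ∈?_) (All.tabulate (walk-head k x t)))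

  walks-avoiding : ∀ k x y t → k < δ y x + δ x t → length (filter (x ∈?_) (walks n k y t)) ≡ 0
  walks-avoiding k x y t k<δ+δ =
    cong length (filter-none (x ∈?_) (All.tabulate (λ p∈ x∈p → <⇒≱ k<δ+δ (walk-through-≥ k y t x p∈ x∈p))))

  filtered-walks-too-short : ∀ k x y t → k < δ y t → length (filter (x ∈?_) (walks n k y t)) ≡ 0
  filtered-walks-too-short k x y t k<δ =
    n≤0⇒n≡0 (≤-trans (length-filter (x ∈?_) (walks n k y t)) (≤-reflexive (walks-too-short k y t k<δ)))

  σvia-off-geodesic : ∀ s t x → δ s t < δ s x + δ x t → σvia n s t x ≡ 0
  σvia-off-geodesic s t x δ<δ+δ rewrite σvia≡walks s t x = walks-avoiding (δ s t) x s t δ<δ+δ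

  σ-neighbours : ∀ s t k → δ s t ≡ suc k → σ n s t ≡ ∑ (λ y → length (walks n k y t)) (neighbours n s)
  σ-neighbours s t k δ≡ rewrite σ≡walks s t | δ≡ =
    trans (length-concatMap (λ w → map (s ∷_) (walks n k w t)) (neighbours n s))
          (∑-cong (neighbours n s) (λ {y} _ → length-map (s ∷_) (walks n k y t)))

  σvia-neighbours : ∀ s t x k → x ≢ s → δ s t ≡ suc k →
                    σvia n s t x ≡ ∑ (λ y → length (filter (x ∈?_) (walks n k y t))) (neighbours n s)
  σvia-neighbours s t x k x≢s δ≡ rewrite σvia≡walks s t x | δ≡ =
    trans (length-filter-concatMap (x ∈?_) (λ w → map (s ∷_) (walks n k w t)) (neighbours n s))
          (∑-cong (neighbours n s) (λ {y} _ → drop-s (walks n k y t)))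
    where
    tail-∈ : ∀ {p} → x ∈ s ∷ p → x ∈ p
    tail-∈ (here x≡s)  = ⊥-elim (x≢s x≡s)
    tail-∈ (there x∈p) = x∈p
    drop-s : ∀ ps → length (filter (x ∈?_) (map (s ∷_) ps)) ≡ length (filter (x ∈?_) ps)
    drop-s ps = trans (length-filter-map (x ∈?_) (s ∷_) ps)
                      (cong length (filter-≐ (λ p → x ∈? (s ∷ p)) (x ∈?_) (tail-∈ , there) ps))

  σ-unique-next : ∀ s t k y₀ → δ s t ≡ suc k → Adj n s y₀ → δ y₀ t ≡ k →
                  (∀ y → Adj n s y → y ≢ y₀ → suc k ≤ δ y t) → σ n s t ≡ σ n y₀ t
  σ-unique-next s t k y₀ δ≡ adj δy₀≡ others =
    trans (σ-neighbours s t k δ≡)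
          (trans (∑-single (neighbours-unique s) (∈-neighbours⁺ adj)
                           (λ {y} y∈ y≢y₀ → walks-too-short k y t (others y (∈-neighbours⁻ s y∈) y≢y₀)))
                 (walks-geodesic k y₀ t δy₀≡))

  σvia-unique-next : ∀ s t k x → x ≢ s → δ s t ≡ suc k → Adj n s x → δ x t ≡ k →
                     (∀ y → Adj n s y → y ≢ x → suc k ≤ δ y t) → σvia n s t x ≡ σ n s t
  σvia-unique-next s t k x x≢s δ≡ adj δx≡ others =
    trans (σvia-neighbours s t x k x≢s δ≡)
          (trans (∑-single (neighbours-unique s) (∈-neighbours⁺ adj)
                           (λ {y} y∈ y≢x → filtered-walks-too-short k x y t (others y (∈-neighbours⁻ s y∈) y≢x)))
                 (trans (walks-through-head k x t)
                        (trans (walks-geodesic k x t δx≡) (sym (σ-unique-next s t k x δ≡ adj δx≡ others)))))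

  σ-two-next : ∀ s t k x y → x ≢ s → x ≢ y → δ s t ≡ suc k → Adj n s x → Adj n s y → δ x t ≡ k → δ y t ≡ k →
               k < δ y x + δ x t → (∀ z → Adj n s z → z ≢ x → z ≢ y → suc k ≤ δ z t) →
               σ n s t ≡ σ n x t + σ n y t × σvia n s t x ≡ σ n x t
  σ-two-next s t k x y x≢s x≢y δ≡ adjx adjy δx≡ δy≡ y-avoids-x others =
    trans (σ-neighbours s t k δ≡)
          (trans (∑-pair (neighbours-unique s) (∈-neighbours⁺ adjx) (∈-neighbours⁺ adjy) x≢y
                         (λ {z} z∈ z≢x z≢y → walks-too-short k z t (others z (∈-neighbours⁻ s z∈) z≢x z≢y)))
                 (cong₂ _+_ (walks-geodesic k x t δx≡) (walks-geodesic k y t δy≡))) ,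
    trans (σvia-neighbours s t x k x≢s δ≡)
          (trans (∑-pair (neighbours-unique s) (∈-neighbours⁺ adjx) (∈-neighbours⁺ adjy) x≢y
                         (λ {z} z∈ z≢x z≢y → filtered-walks-too-short k x z t (others z (∈-neighbours⁻ s z∈) z≢x z≢y)))
                 (trans (cong₂ _+_ (trans (walks-through-head k x t) (walks-geodesic k x t δx≡))
                                   (walks-avoiding k x y t y-avoids-x))
                        (+-identityʳ _)))

  -- The other arc between c and j has length M + 2, and the bounds on R make it the longer way
  -- round, so the inner-rim path is the only geodesic.
  inner-geodesic-unique : ∀ R M (c j : Fin n) d → n ≡ M + 2 + (R + R) → R ≤ ladderVV M → R ≤ suc (ladderUV M) →
                          Apart d (R + R) (toℕ c) (toℕ j) →
                          δ (false , c) (false , j) ≡ R × σ n (false , c) (false , j) ≡ 1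
  inner-geodesic-unique zero M c j d _ _ _ ap with toℕ-injective (apart-zero d (toℕ<n c) (toℕ<n j) ap)
  ... | refl = δ-self (false , c) , σ-self (false , c)
  inner-geodesic-unique (suc r) M c j d n≡ R≤vv R≤1+uv ap =
    δ≡R , trans (σ-unique-next (false , c) (false , j) r y₀ δ≡R (toward-adj false c d) (proj₁ rest) others) (proj₂ rest)
    where
    R = suc r
    y₀ : Vtx n
    y₀ = false , toward false c d
    δ≡R : δ (false , c) (false , j) ≡ R
    δ≡R = trans (δ-arcs false false d (M + 2) c j n≡ ap)
                (trans (cong₂ _⊓_ (ladderVV-even R) (ladderVV-+2 M)) (m≤n⇒m⊓n≡m (m≤n⇒m≤1+n R≤vv)))
    rest = inner-geodesic-unique r (M + 2) (toward false c d) j d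
             (trans n≡ (solve 2 (λ M r → M :+ con 2 :+ ((con 1 :+ r) :+ (con 1 :+ r)) := M :+ con 2 :+ con 2 :+ (r :+ r)) refl M r))
             (≤-trans (n≤1+n r) (≤-trans R≤vv (≤-trans (n≤1+n _) (≤-reflexive (sym (ladderVV-+2 M))))))
             (≤-trans (n≤1+n r) (≤-trans R≤1+uv (s≤s (≤-trans (n≤1+n _) (≤-reflexive (sym (ladderUV-+2 M)))))))
             (toward-apart false d c j (cong suc (sym (+-suc r r))) ap)
    others : ∀ y → Adj n (false , c) y → y ≢ y₀ → R ≤ δ y (false , j)
    others (true , _) refl _ = subst (R ≤_) (sym δ-spoke) (⊓-glb (n≤1+n R) R≤1+uv)
      where
      δ-spoke = trans (δ-arcs true false d (M + 2) c j n≡ ap) (cong₂ _⊓_ (ladderUV-even R) (ladderUV-+2 M))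
    others (false , c′) adj c′≢y₀ with rim-neighbour false d c c′ j ap adj
    ... | inj₁ c′≡ = ⊥-elim (c′≢y₀ (cong (false ,_) c′≡))
    ... | inj₂ ap′ = subst (R ≤_) (sym δ-away) (⊓-glb (n≤1+n R) R≤vv)
      where
      δ-away = trans (δ-arcs false false d M c′ j (trans n≡ (+-assoc M 2 (R + R))) ap′)
                     (cong (_⊓ ladderVV M) (cong suc (ladderVV-even R)))

  spoke-geodesic-unique : ∀ r M (c j : Fin n) d → n ≡ M + 2 + (suc r + suc r) → suc r ≤ ladderVV M →
                          suc (suc r) ≤ ladderUV (suc M) → Apart d (suc r + suc r) (toℕ c) (toℕ j) →
                          δ (true , c) (false , j) ≡ suc (suc r) × σ n (true , c) (false , j) ≡ 1
  spoke-geodesic-unique r M c j d n≡ R≤vv 1+R≤uv ap =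
    δ≡1+R , trans (σ-unique-next (true , c) (false , j) R (false , c) δ≡1+R refl (proj₁ inner) others) (proj₂ inner)
    where
    R = suc r
    R≤uv : R ≤ ladderUV M
    R≤uv = ≤-pred (≤-trans 1+R≤uv (ladderUV-suc-≤ M))
    δ≡1+R : δ (true , c) (false , j) ≡ suc R
    δ≡1+R = trans (δ-arcs true false d (M + 2) c j n≡ ap)
                  (trans (cong₂ _⊓_ (ladderUV-even R) (ladderUV-+2 M)) (m≤n⇒m⊓n≡m (s≤s R≤uv)))
    inner = inner-geodesic-unique R M c j d n≡ R≤vv (m≤n⇒m≤1+n R≤uv) ap
    others : ∀ y → Adj n (true , c) y → y ≢ (false , c) → suc R ≤ δ y (false , j)
    others (false , _) refl ≢spoke = ⊥-elim (≢spoke refl)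
    others (true , c′) adj _ with rim-neighbour true d c c′ j ap adj
    ... | inj₁ refl = subst (suc R ≤_) (sym δ-toward)
                            (⊓-glb ≤-refl (≤-trans 1+R≤uv (ladderUV-mono-≤ (subst (suc M ≤_) (+-comm 3 M) (s≤s (m≤n+m M 2))))))
      where
      δ-toward = trans (δ-arcs true false d (M + 3) (toward true c d) j
                                (trans n≡ (solve 2 (λ M r → M :+ con 2 :+ ((con 1 :+ r) :+ (con 1 :+ r))
                                                           := M :+ con 3 :+ (r :+ (con 1 :+ r))) refl M r))
                                (toward-apart true d c j refl ap))
                       (cong (_⊓ ladderUV (M + 3)) (trans (cong ladderUV (+-suc r r)) (ladderUV-odd r)))
    ... | inj₂ ap′ = subst (suc R ≤_) (sym δ-away) (⊓-glb (n≤1+n _) 1+R≤uv)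
      where
      δ-away = trans (δ-arcs true false d (suc M) c′ j
                              (trans n≡ (solve 2 (λ M R → M :+ con 2 :+ (R :+ R) := con 1 :+ M :+ (con 1 :+ (R :+ R))) refl M R))
                              ap′)
                     (cong (_⊓ ladderUV (suc M)) (ladderUV-odd R))

𝟙 : {P : Set} → Dec P → ℕ
𝟙 (yes _) = 1
𝟙 (no  _) = 0

𝟙-yes : ∀ {P : Set} (P? : Dec P) → P → 𝟙 P? ≡ 1
𝟙-yes (yes _) _  = refl
𝟙-yes (no ¬p) p = ⊥-elim (¬p p)

𝟙-no : ∀ {P : Set} (P? : Dec P) → ¬ P → 𝟙 P? ≡ 0
𝟙-no (yes p) ¬p = ⊥-elim (¬p p)
𝟙-no (no  _) _  = refl

𝟙-⇔ : ∀ {P Q : Set} (P? : Dec P) (Q? : Dec Q) → (P → Q) → (Q → P) → 𝟙 P? ≡ 𝟙 Q?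
𝟙-⇔ (yes _) (yes _) _   _   = refl
𝟙-⇔ (no  _) (no  _) _   _   = refl
𝟙-⇔ (yes p) (no ¬q) p→q _   = ⊥-elim (¬q (p→q p))
𝟙-⇔ (no ¬p) (yes q) _   q→p = ⊥-elim (¬p (q→p q))

even-or-odd : ∀ J → ∃ λ p → J ≡ p + p ⊎ J ≡ suc (p + p)
even-or-odd zero          = 0 , inj₁ refl
even-or-odd (suc zero)    = 0 , inj₂ refl
even-or-odd (suc (suc J)) with even-or-odd J
... | p , inj₁ refl = suc p , inj₁ (cong suc (sym (+-suc p p)))
... | p , inj₂ refl = suc p , inj₂ (cong (λ w → suc (suc w)) (sym (+-suc p p)))

-- weight N J is twice the share of the geodesics from an outer neighbour u of x to a target t
-- that pass through x, where t lies J steps beyond x the other way round a rim of length N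
-- (the row analysis in Betweenness): 2 if 2J + 4 ≤ N, 1 if 2J + 2 ≤ N < 2J + 4, and 0
-- if J is odd or 2J + 2 > N.
evenWeight : ℕ → ℕ → ℕ
evenWeight N p = 𝟙 (p + p + (p + p) + 4 ≤? N) + 𝟙 (p + p + (p + p) + 2 ≤? N)

weightFrom : ℕ → ℕ → ℕ → ℕ
weightFrom N zero          p = evenWeight N p
weightFrom N (suc zero)    p = 0
weightFrom N (suc (suc J)) p = weightFrom N J (suc p)

weight : ℕ → ℕ → ℕ
weight N J = weightFrom N J 0

weight-even : ∀ N p → weight N (p + p) ≡ evenWeight N p
weight-even N p = trans (go p 0) (cong (evenWeight N) (+-identityʳ p))
  where
  go : ∀ q p → weightFrom N (q + q) p ≡ evenWeight N (q + p)
  go zero    p = refl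
  go (suc q) p rewrite +-suc q q | go q (suc p) | +-suc q p = refl

weight-odd : ∀ N p → weight N (suc (p + p)) ≡ 0
weight-odd N p = go p 0
  where
  go : ∀ q p → weightFrom N (suc (q + q)) p ≡ 0
  go zero    p = refl
  go (suc q) p rewrite +-suc q q = go q (suc p)

weightFrom-+4 : ∀ N J p → weightFrom (4 + N) J (suc p) ≡ weightFrom N J p
weightFrom-+4 N zero          p = cong₂ _+_ (𝟙-⇔ (Y + 4 ≤? 4 + N) (X + 4 ≤? N) (shift⁻ 4) (shift⁺ 4))
                                            (𝟙-⇔ (Y + 2 ≤? 4 + N) (X + 2 ≤? N) (shift⁻ 2) (shift⁺ 2))
  where
  X = p + p + (p + p)
  Y = suc p + suc p + (suc p + suc p)
  Y+a≡ : ∀ a → Y + a ≡ 4 + (X + a)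
  Y+a≡ a = solve 2 (λ p a → (con 1 :+ p) :+ (con 1 :+ p) :+ ((con 1 :+ p) :+ (con 1 :+ p)) :+ a
                             := con 4 :+ (p :+ p :+ (p :+ p) :+ a)) refl p a
  shift⁻ : ∀ a → Y + a ≤ 4 + N → X + a ≤ N
  shift⁻ a le = +-cancelˡ-≤ 4 (X + a) N (subst (_≤ 4 + N) (Y+a≡ a) le)
  shift⁺ : ∀ a → X + a ≤ N → Y + a ≤ 4 + N
  shift⁺ a le = subst (_≤ 4 + N) (sym (Y+a≡ a)) (+-monoʳ-≤ 4 le)
weightFrom-+4 N (suc zero)    p = refl
weightFrom-+4 N (suc (suc J)) p = weightFrom-+4 N J (suc p)

weight-≥ : ∀ N J → N ≤ J → weight N J ≡ 0
weight-≥ N J N≤J with even-or-odd J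
... | p , inj₂ refl = weight-odd N p
... | p , inj₁ refl = trans (weight-even N p) (cong₂ _+_ (𝟙-no (X + 4 ≤? N) (too-big ∘ ≤-trans (+-monoʳ-≤ X (s≤s (s≤s z≤n)))))
                                                         (𝟙-no (X + 2 ≤? N) too-big))
  where
  X = p + p + (p + p)
  too-big : ¬ (X + 2 ≤ N)
  too-big le = <⇒≱ (m<m+n X z<s) (≤-trans le (≤-trans N≤J (m≤m+n (p + p) (p + p))))

∑-weight : ∀ N → ∑< N (weight N) ≡ ⌊ N /2⌋
∑-weight zero                      = refl
∑-weight (suc zero)                = refl
∑-weight (suc (suc zero))          = refl
∑-weight (suc (suc (suc zero)))    = refl
∑-weight (suc (suc (suc (suc N)))) = cong₂ _+_ first-two (begin
  ∑< (2 + N) (λ J → weight (4 + N) (2 + J)) ≡⟨ ∑<-cong (2 + N) (λ {J} _ → weightFrom-+4 N J 0) ⟩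
  ∑< (2 + N) (weight N)                     ≡⟨ cong (λ k → ∑< k (weight N)) (+-comm 2 N) ⟩
  ∑< (N + 2) (weight N)                     ≡⟨ ∑<-+ N 2 (weight N) ⟩
  ∑< N (weight N) + (weight N (N + 0) + (weight N (N + 1) + 0))
    ≡⟨ cong₂ _+_ (∑-weight N) (cong₂ _+_ (weight-≥ N (N + 0) (m≤m+n N 0)) (cong (_+ 0) (weight-≥ N (N + 1) (m≤m+n N 1)))) ⟩
  ⌊ N /2⌋ + 0                               ≡⟨ +-identityʳ _ ⟩
  ⌊ N /2⌋                                   ∎)
  where
  open ≡-Reasoning
  first-two : weight (4 + N) 0 + weight (4 + N) 1 ≡ 2
  first-two = cong₂ _+_ (cong₂ _+_ (𝟙-yes (0 + 4 ≤? 4 + N) (m≤m+n 4 N))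
                                   (𝟙-yes (0 + 2 ≤? 4 + N) (≤-trans (s≤s (s≤s z≤n)) (m≤m+n 4 N)))) refl

⌊n/2⌋+⌊n/2⌋+n%2≡n : ∀ n → ⌊ n /2⌋ + ⌊ n /2⌋ + n % 2 ≡ n
⌊n/2⌋+⌊n/2⌋+n%2≡n zero          = refl
⌊n/2⌋+⌊n/2⌋+n%2≡n (suc zero)    = refl
⌊n/2⌋+⌊n/2⌋+n%2≡n (suc (suc n)) = begin
  suc h + suc h + suc (suc n) % 2 ≡⟨ cong (suc h + suc h +_) (trans (cong (_% 2) (+-comm 2 n)) ([m+n]%n≡m%n n 2)) ⟩
  suc h + suc h + n % 2           ≡⟨ cong (λ w → suc w + n % 2) (+-suc h h) ⟩
  suc (suc (h + h + n % 2))       ≡⟨ cong (λ w → suc (suc w)) (⌊n/2⌋+⌊n/2⌋+n%2≡n n) ⟩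
  suc (suc n)                     ∎
  where
  open ≡-Reasoning
  h = ⌊ n /2⌋

-- Imported only here: its prefix operator +_ makes sections such as (x +_) ambiguous.
open import Data.Integer using (+_) renaming (_+_ to _+ℤ_; _*_ to _*ℤ_)

frac-zero : ∀ b → frac 0 b ≡ (+ 0) / 2
frac-zero zero    = sym (0/n≡0 2)
frac-zero (suc b) = trans (0/n≡0 (suc b)) (sym (0/n≡0 2))

frac-self : ∀ {b} → 0 < b → frac b b ≡ (+ 2) / 2
frac-self {suc b} _ = fromℚᵘ-cong {ℚᵘ.mkℚᵘ (+ suc b) b} {ℚᵘ.mkℚᵘ (+ 2) 1} (ℚᵘ.*≡* (ℤ.*-comm (+ suc b) (+ 2)))

halves-+ : ∀ a b → (+ a) / 2 +ℚ (+ b) / 2 ≡ (+ (a + b)) / 2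
halves-+ a b = toℚᵘ-injective (begin
  toℚᵘ ((+ a) / 2 +ℚ (+ b) / 2)          ≈⟨ toℚᵘ-homo-+ ((+ a) / 2) ((+ b) / 2) ⟩
  toℚᵘ ((+ a) / 2) ℚᵘ.+ toℚᵘ ((+ b) / 2)
    ≈⟨ ℚᵘₚ.+-cong (toℚᵘ-fromℚᵘ (ℚᵘ.mkℚᵘ (+ a) 1)) (toℚᵘ-fromℚᵘ (ℚᵘ.mkℚᵘ (+ b) 1)) ⟩
  ℚᵘ.mkℚᵘ (+ a) 1 ℚᵘ.+ ℚᵘ.mkℚᵘ (+ b) 1   ≈⟨ ℚᵘ.*≡* cross ⟩
  ℚᵘ.mkℚᵘ (+ (a + b)) 1                  ≈⟨ toℚᵘ-fromℚᵘ (ℚᵘ.mkℚᵘ (+ (a + b)) 1) ⟨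
  toℚᵘ ((+ (a + b)) / 2)                 ∎)
  where
  open ℚᵘₚ.≃-Reasoning
  cross : (+ a *ℤ + 2 +ℤ + b *ℤ + 2) *ℤ + 2 ≡ + (a + b) *ℤ + 4
  cross = trans (cong (_*ℤ + 2) (sym (ℤ.*-distribʳ-+ (+ 2) (+ a) (+ b))))
                (trans (ℤ.*-assoc (+ a +ℤ + b) (+ 2) (+ 2)) (cong (_*ℤ + 4) (sym (ℤ.pos-+ a b))))

sumℚ-halves : ∀ xs (F : A → ℚ) (w : A → ℕ) →
              (∀ {x} → x ∈ xs → F x ≡ (+ w x) / 2) → sumℚ (map F xs) ≡ (+ ∑ w xs) / 2
sumℚ-halves []       F w F≡w = frac-zero 0
sumℚ-halves (x ∷ xs) F w F≡w =
  trans (cong₂ _+ℚ_ (F≡w (here refl)) (sumℚ-halves xs F w (F≡w ∘ there))) (halves-+ (w x) (∑ w xs))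

module Betweenness (m : ℕ) (5≤n : 5 ≤ suc m) where

  n : ℕ
  n = suc m

  open Circular n
  open Distance n 5≤n
  open PathCounting n 5≤n

  share : Vtx n → Vtx n → Vtx n → ℚ
  share x s t = frac (σvia n s t x) (σ n s t)

  -- An outer neighbour s = u cs of x = u cx and a target t = v j with x, s, t in this order
  -- along an arc: E steps from s to t, and J steps from t on to x.  y₂ = u c₂ and
  -- y₃ = v cs are the other neighbours of s.
  record Configuration (J E : ℕ) : Set where
    field
      cs cx c₂ j   : Fin n
      ds dx d₂     : Bool
      n≡1+J+E      : n ≡ suc (J + E)
      s~x          : Adj n (true , cs) (true , cx)
      s~y₂         : Adj n (true , cs) (true , c₂)
      cx≢cs        : cx ≢ cs
      neighbours-s : ∀ y → Adj n (true , cs) y → y ≡ (true , cx) ⊎ y ≡ (true , c₂) ⊎ y ≡ (false , cs)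
      s-t          : Apart ds E (toℕ cs) (toℕ j)
      x-t          : Apart dx (suc E) (toℕ cx) (toℕ j)
      y₂-t         : ∀ E′ → E ≡ suc E′ → Apart d₂ E′ (toℕ c₂) (toℕ j)
      δsx          : δ (true , cs) (true , cx) ≡ 1
      δy₂x         : δ (true , c₂) (true , cx) ≡ 2
      δy₃x         : δ (false , cs) (true , cx) ≡ 2

  module Row {J E : ℕ} (cfg : Configuration J E) where

    open Configuration cfg

    s x t y₂ y₃ : Vtx n
    s  = true  , cs
    x  = true  , cx
    t  = false , j
    y₂ = true  , c₂
    y₃ = false , cs

    δst : δ s t ≡ ladderUV E ⊓ ladderUV (suc J)
    δst = δ-arcs true false ds (suc J) cs j n≡1+J+E s-t

    δxt : δ x t ≡ ladderUV (suc E) ⊓ ladderUV J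
    δxt = δ-arcs true false dx J cx j (trans n≡1+J+E (sym (+-suc J E))) x-t

    δy₂t : ∀ E′ → E ≡ suc E′ → δ y₂ t ≡ ladderUV E′ ⊓ ladderUV (J + 2)
    δy₂t E′ refl = δ-arcs true false d₂ (J + 2) c₂ j
                          (trans n≡1+J+E (solve 2 (λ J E′ → con 1 :+ (J :+ (con 1 :+ E′)) := J :+ con 2 :+ E′) refl J E′))
                          (y₂-t E′ refl)

    δy₃t : δ y₃ t ≡ ladderVV E ⊓ ladderVV (suc J)
    δy₃t = δ-arcs false false ds (suc J) cs j n≡1+J+E s-t

    x≢s : x ≢ s
    x≢s x≡s = cx≢cs (cong proj₂ x≡s)

    share-none : δ s t ≤ δ x t → share x s t ≡ (+ 0) / 2
    share-none δst≤δxt =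
      trans (cong (λ w → frac w (σ n s t)) (σvia-off-geodesic s t x (subst (λ w → δ s t < w + δ x t) (sym δsx) (s≤s δst≤δxt))))
            (frac-zero (σ n s t))

    share-half : ∀ k y → Adj n s y → δ y t ≡ k → δ y x ≡ 2 → (∀ z → Adj n s z → z ≢ x → z ≢ y → suc k ≤ δ z t) →
                 δ s t ≡ suc k → δ x t ≡ k → σ n x t ≡ 1 → σ n y t ≡ 1 → share x s t ≡ (+ 1) / 2
    share-half k y s~y δyt δyx others δst≡ δxt≡ σxt σyt
      with σ-two-next s t k x y x≢s x≢y δst≡ s~x s~y δxt≡ δyt y-avoids-x others
      where
      x≢y : x ≢ y
      x≢y refl = 0≢1+n (trans (sym (δ-self x)) δyx)
      y-avoids-x : k < δ y x + δ x t
      y-avoids-x rewrite δyx | δxt≡ = s≤s (n≤1+n k)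
    ... | σst≡ , σvia≡ rewrite σst≡ | σvia≡ | σxt | σyt = refl

    share-all : ∀ k → δ s t ≡ suc k → δ x t ≡ k → suc k ≤ δ y₂ t → suc k ≤ δ y₃ t → share x s t ≡ (+ 2) / 2
    share-all k δst≡ δxt≡ far₂ far₃ =
      trans (cong (λ w → frac w (σ n s t)) (σvia-unique-next s t k x x≢s δst≡ s~x δxt≡ others))
            (frac-self (σ-positive s t))
      where
      others : ∀ z → Adj n s z → z ≢ x → suc k ≤ δ z t
      others z s~z z≢x with neighbours-s z s~z
      ... | inj₁ z≡x         = ⊥-elim (z≢x z≡x)
      ... | inj₂ (inj₁ refl) = far₂
      ... | inj₂ (inj₂ refl) = far₃

    share≡weight : ∀ w → weight n J ≡ w → share x s t ≡ (+ w) / 2 → share x s t ≡ (+ weight n J) / 2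
    share≡weight w weight≡w share≡ = trans share≡ (cong (λ v → (+ v) / 2) (sym weight≡w))

    row-odd : ∀ p → J ≡ suc (p + p) → share x s t ≡ (+ weight n J) / 2
    row-odd p J≡1+2p = share≡weight 0 (trans (cong (weight n) J≡1+2p) (weight-odd n p))
                         (share-none (subst₂ _≤_ (sym δst) (sym δxt) (⊓-mono-≤ (ladderUV-≤-suc E) uv≤uv)))
      where
      uv≤uv : ladderUV (suc J) ≤ ladderUV J
      uv≤uv = subst (λ w → ladderUV (suc w) ≤ ladderUV w) (sym J≡1+2p)
                    (≤-reflexive (trans (cong suc (ladderUV-even p)) (sym (ladderUV-odd p))))

    row-short : ∀ p → J ≡ p + p → E ≤ p + p → share x s t ≡ (+ weight n J) / 2
    row-short p J≡2p E≤2p = share≡weight 0 weight≡0 (share-none δst≤δxt)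
      where
      δst≤δxt : δ s t ≤ δ x t
      δst≤δxt = subst₂ _≤_ (sym δst) (sym δxt)
                       (≤-trans (m⊓n≤m _ _) (⊓-glb (ladderUV-≤-suc E) (ladderUV-mono-≤ (subst (E ≤_) (sym J≡2p) E≤2p))))
      X = p + p + (p + p)
      n≤1+X : n ≤ suc X
      n≤1+X = subst (_≤ suc X) (sym (trans n≡1+J+E (cong (λ w → suc (w + E)) J≡2p))) (s≤s (+-monoʳ-≤ (p + p) E≤2p))
      too-big : ¬ (X + 2 ≤ n)
      too-big le = 1+n≰n (+-cancelˡ-≤ X 2 1 (≤-trans le (≤-trans n≤1+X (≤-reflexive (+-comm 1 X)))))
      weight≡0 : weight n J ≡ 0
      weight≡0 = trans (cong (weight n) J≡2p)
                       (trans (weight-even n p) (cong₂ _+_ (𝟙-no (X + 4 ≤? n) (too-big ∘ ≤-trans (+-monoʳ-≤ X (s≤s (s≤s z≤n)))))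
                                                           (𝟙-no (X + 2 ≤? n) too-big)))

    module Beyond (p extra : ℕ) (J≡2p : J ≡ p + p) (E≡ : E ≡ suc (p + p) + extra) where

      X = p + p + (p + p)

      n≡X+2+extra : n ≡ X + (2 + extra)
      n≡X+2+extra = trans n≡1+J+E (trans (cong₂ (λ a b → suc (a + b)) J≡2p E≡)
        (solve 2 (λ p e → con 1 :+ (p :+ p :+ (con 1 :+ (p :+ p) :+ e)) := p :+ p :+ (p :+ p) :+ (con 2 :+ e)) refl p extra))

      δst≡ : δ s t ≡ suc (suc p)
      δst≡ = trans δst (trans (cong₂ (λ a b → ladderUV a ⊓ ladderUV b) E≡ (cong suc J≡2p))
                              (trans (m≥n⇒m⊓n≡n (ladderUV-mono-≤ (m≤m+n (suc (p + p)) extra))) (ladderUV-odd p)))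

      δxt≡ : δ x t ≡ suc p
      δxt≡ = trans δxt (trans (cong₂ (λ a b → ladderUV a ⊓ ladderUV b) (cong suc E≡) J≡2p)
                              (trans (m≥n⇒m⊓n≡n (ladderUV-mono-≤ (m≤n⇒m≤1+n (m≤n⇒m≤1+n (m≤m+n (p + p) extra)))))
                                     (ladderUV-even p)))

      share≡evenWeight : ∀ w → evenWeight n p ≡ w → share x s t ≡ (+ w) / 2 → share x s t ≡ (+ weight n J) / 2
      share≡evenWeight w evenWeight≡w = share≡weight w (trans (cong (weight n) J≡2p) (trans (weight-even n p) evenWeight≡w))

      fits : ∀ a → a ≤ 2 + extra → 𝟙 (X + a ≤? n) ≡ 1
      fits a a≤ = 𝟙-yes (X + a ≤? n) (subst (X + a ≤_) (sym n≡X+2+extra) (+-monoʳ-≤ X a≤))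

      exceeds : ∀ a → 3 + extra ≤ a → 𝟙 (X + a ≤? n) ≡ 0
      exceeds a ≤a = 𝟙-no (X + a ≤? n) (λ le → <⇒≱ ≤a (+-cancelˡ-≤ X a (2 + extra) (subst (X + a ≤_) n≡X+2+extra le)))

      σxt≡1 : ∀ r M → p ≡ suc r → n ≡ M + 2 + (p + p) → suc r ≤ ladderVV M → suc (suc r) ≤ ladderUV (suc M) → σ n x t ≡ 1
      σxt≡1 r M refl n≡ vv≥ uv≥ = proj₂ (spoke-geodesic-unique r M cx j (not dx) n≡ vv≥ uv≥ x-t′)
        where
        n≡J+1+E : n ≡ J + suc E
        n≡J+1+E = trans n≡1+J+E (sym (+-suc J E))
        x-t′ : Apart (not dx) (suc r + suc r) (toℕ cx) (toℕ j)
        x-t′ = subst (λ a → Apart (not dx) a (toℕ cx) (toℕ j)) (trans (trans (cong (_∸ suc E) n≡J+1+E) (m+n∸n≡m J (suc E))) J≡2p)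
                     (apart-complement dx (subst (suc E ≤_) (sym n≡J+1+E) (m≤n+m (suc E) J)) x-t)

    half-positive : ∀ p extra → J ≡ p + p → E ≡ suc (p + p) + extra → extra ≤ 1 → ∃ λ r → p ≡ suc r
    half-positive (suc r) _     _    _   _       = r , refl
    half-positive zero    extra J≡0 E≡ extra≤1 = ⊥-elim (<⇒≱ (s≤s (s≤s (s≤s (s≤s z≤n)))) (≤-trans 5≤n n≤3))
      where
      n≤3 : n ≤ 3
      n≤3 = subst (_≤ 3) (sym (trans n≡1+J+E (cong₂ (λ a b → suc (a + b)) J≡0 E≡))) (+-monoʳ-≤ 2 extra≤1)

    -- E = J + 1: one geodesic from s runs through x and one through y₂.
    row-tight₁ : ∀ r → J ≡ suc r + suc r → E ≡ suc (suc r + suc r) + 0 → share x s t ≡ (+ weight n J) / 2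
    row-tight₁ r J≡2p E≡ =
      share≡evenWeight 1 weight≡1 (share-half (suc p) y₂ s~y₂ δy₂t≡ δy₂x others δst≡ δxt≡ σxt σy₂t)
      where
      p = suc r
      open Beyond p 0 J≡2p E≡
      weight≡1 : evenWeight n p ≡ 1
      weight≡1 = cong₂ _+_ (exceeds 4 (s≤s (s≤s (s≤s z≤n)))) (fits 2 ≤-refl)
      E≡1+2p : E ≡ suc (p + p)
      E≡1+2p = trans E≡ (cong suc (+-identityʳ (p + p)))
      δy₂t≡ : δ y₂ t ≡ suc p
      δy₂t≡ = trans (δy₂t (p + p) E≡1+2p)
                    (trans (cong (λ w → ladderUV (p + p) ⊓ ladderUV (w + 2)) J≡2p)
                           (trans (cong₂ _⊓_ (ladderUV-even p) (trans (ladderUV-+2 (p + p)) (cong suc (ladderUV-even p))))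
                                  (m≤n⇒m⊓n≡m (n≤1+n _))))
      far₃ : suc (suc p) ≤ δ y₃ t
      far₃ = subst (suc (suc p) ≤_) (sym δy₃t≡) (⊓-glb (n≤1+n _) (n≤1+n _))
        where
        δy₃t≡ = trans δy₃t (trans (cong₂ (λ a b → ladderVV a ⊓ ladderVV b) E≡1+2p (cong suc J≡2p))
                                  (cong₂ _⊓_ (ladderVV-odd p) (ladderVV-odd p)))
      others : ∀ z → Adj n s z → z ≢ x → z ≢ y₂ → suc (suc p) ≤ δ z t
      others z s~z z≢x z≢y₂ with neighbours-s z s~z
      ... | inj₁ z≡x         = ⊥-elim (z≢x z≡x)
      ... | inj₂ (inj₁ z≡y₂) = ⊥-elim (z≢y₂ z≡y₂)
      ... | inj₂ (inj₂ refl) = far₃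
      n≡ : n ≡ p + p + 2 + (p + p)
      n≡ = trans n≡X+2+extra (solve 1 (λ p → p :+ p :+ (p :+ p) :+ (con 2 :+ con 0) := p :+ p :+ con 2 :+ (p :+ p)) refl p)
      vv≥ : suc r ≤ ladderVV (p + p)
      vv≥ = ≤-reflexive (sym (ladderVV-even p))
      uv≥ : suc (suc r) ≤ ladderUV (suc (p + p))
      uv≥ = subst (suc p ≤_) (sym (ladderUV-odd p)) (n≤1+n _)
      σxt : σ n x t ≡ 1
      σxt = σxt≡1 r (p + p) refl n≡ vv≥ uv≥
      σy₂t : σ n y₂ t ≡ 1
      σy₂t = proj₂ (spoke-geodesic-unique r (p + p) c₂ j d₂ n≡ vv≥ uv≥ (y₂-t (p + p) E≡1+2p))

    -- E = J + 2: one geodesic from s runs through x and one down the spoke to y₃.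
    row-tight₂ : ∀ r → J ≡ suc r + suc r → E ≡ suc (suc r + suc r) + 1 → share x s t ≡ (+ weight n J) / 2
    row-tight₂ r J≡2p E≡ =
      share≡evenWeight 1 weight≡1 (share-half (suc p) y₃ refl δy₃t≡ δy₃x others δst≡ δxt≡ σxt σy₃t)
      where
      p = suc r
      open Beyond p 1 J≡2p E≡
      weight≡1 : evenWeight n p ≡ 1
      weight≡1 = cong₂ _+_ (exceeds 4 ≤-refl) (fits 2 (n≤1+n 2))
      E≡2+2p : E ≡ suc (suc (p + p))
      E≡2+2p = trans E≡ (cong suc (+-comm (p + p) 1))
      δy₃t≡ : δ y₃ t ≡ suc p
      δy₃t≡ = trans δy₃t (trans (cong₂ (λ a b → ladderVV a ⊓ ladderVV b) E≡2+2p (cong suc J≡2p))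
                                (trans (cong₂ _⊓_ (cong suc (ladderVV-even p)) (ladderVV-odd p))
                                       (m≤n⇒m⊓n≡m (m≤n+m (suc p) 2))))
      far₂ : suc (suc p) ≤ δ y₂ t
      far₂ = ≤-reflexive (sym (trans (δy₂t (suc (p + p)) E≡2+2p)
                                     (trans (cong (λ w → ladderUV (suc (p + p)) ⊓ ladderUV (w + 2)) J≡2p)
                                            (trans (cong₂ _⊓_ (ladderUV-odd p) (trans (ladderUV-+2 (p + p)) (cong suc (ladderUV-even p))))
                                                   (⊓-idem _)))))
      others : ∀ z → Adj n s z → z ≢ x → z ≢ y₃ → suc (suc p) ≤ δ z t
      others z s~z z≢x z≢y₃ with neighbours-s z s~z
      ... | inj₁ z≡x         = ⊥-elim (z≢x z≡x)
      ... | inj₂ (inj₁ refl) = far₂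
      ... | inj₂ (inj₂ z≡y₃) = ⊥-elim (z≢y₃ z≡y₃)
      n≡ : n ≡ suc (p + p) + 2 + (p + p)
      n≡ = trans n≡X+2+extra (solve 1 (λ p → p :+ p :+ (p :+ p) :+ (con 2 :+ con 1) := con 1 :+ (p :+ p) :+ con 2 :+ (p :+ p)) refl p)
      σxt : σ n x t ≡ 1
      σxt = σxt≡1 r (suc (p + p)) refl n≡ (subst (suc r ≤_) (sym (ladderVV-odd p)) (m≤n+m (suc r) 3))
                                          (subst (suc p ≤_) (sym (cong suc (ladderUV-even p))) (n≤1+n (suc p)))
      n≡′ : n ≡ suc (r + r) + 2 + (suc p + suc p)
      n≡′ = trans n≡X+2+extra (solve 1 (λ r → (con 1 :+ r) :+ (con 1 :+ r) :+ ((con 1 :+ r) :+ (con 1 :+ r)) :+ (con 2 :+ con 1)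
                                              := con 1 :+ (r :+ r) :+ con 2 :+ ((con 2 :+ r) :+ (con 2 :+ r))) refl r)
      s-t′ : Apart ds (suc p + suc p) (toℕ cs) (toℕ j)
      s-t′ = subst (λ a → Apart ds a (toℕ cs) (toℕ j)) (trans E≡2+2p (cong suc (sym (+-suc p p)))) s-t
      σy₃t : σ n y₃ t ≡ 1
      σy₃t = proj₂ (inner-geodesic-unique (suc p) (suc (r + r)) cs j ds n≡′
                                          (subst (suc p ≤_) (sym (ladderVV-odd r)) (n≤1+n _))
                                          (subst (suc p ≤_) (sym (cong suc (ladderUV-odd r))) (n≤1+n _)) s-t′)

    -- E ≥ J + 3: every geodesic from s runs through x.
    row-long : ∀ p extra → J ≡ p + p → E ≡ suc (p + p) + suc (suc extra) → share x s t ≡ (+ weight n J) / 2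
    row-long p extra J≡2p E≡ = share≡evenWeight 2 weight≡2 (share-all (suc p) δst≡ δxt≡ far₂ far₃)
      where
      open Beyond p (suc (suc extra)) J≡2p E≡
      weight≡2 : evenWeight n p ≡ 2
      weight≡2 = cong₂ _+_ (fits 4 (s≤s (s≤s (s≤s (s≤s z≤n))))) (fits 2 (m≤m+n 2 (suc (suc extra))))
      E′ = p + p + suc (suc extra)
      uv[2p+2]≡ : ladderUV (p + p + 2) ≡ suc (suc p)
      uv[2p+2]≡ = trans (ladderUV-+2 (p + p)) (cong suc (ladderUV-even p))
      far₂ : suc (suc p) ≤ δ y₂ t
      far₂ = subst (suc (suc p) ≤_) (sym (trans (δy₂t E′ E≡) (cong (λ w → ladderUV E′ ⊓ ladderUV (w + 2)) J≡2p)))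
                   (⊓-glb (≤-trans (≤-reflexive (sym uv[2p+2]≡)) (ladderUV-mono-≤ (+-monoʳ-≤ (p + p) (s≤s (s≤s z≤n)))))
                          (≤-reflexive (sym uv[2p+2]≡)))
      E≡3+2p+extra : E ≡ 3 + (p + p) + extra
      E≡3+2p+extra = trans E≡ (cong suc (trans (+-suc (p + p) (suc extra)) (cong suc (+-suc (p + p) extra))))
      far₃ : suc (suc p) ≤ δ y₃ t
      far₃ = subst (suc (suc p) ≤_) (sym (trans δy₃t (cong₂ (λ a b → ladderVV a ⊓ ladderVV b) E≡3+2p+extra (cong suc J≡2p))))
                   (⊓-glb (ladderVV-odd+ p extra) (subst (suc (suc p) ≤_) (sym (ladderVV-odd p)) (s≤s (s≤s (n≤1+n p)))))

    row : share x s t ≡ (+ weight n J) / 2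
    row with even-or-odd J
    ... | p , inj₂ J≡1+2p = row-odd p J≡1+2p
    ... | p , inj₁ J≡2p with E ≤? p + p
    ...   | yes E≤2p = row-short p J≡2p E≤2p
    ...   | no  E≰2p with m≤n⇒∃[o]m+o≡n (≰⇒> E≰2p)
    ...     | suc (suc extra) , E≡ = row-long p extra J≡2p (sym E≡)
    ...     | zero , E≡ with half-positive p 0 J≡2p (sym E≡) z≤n
    ...       | r , refl = row-tight₁ r J≡2p (sym E≡)
    row | p , inj₁ J≡2p | no E≰2p | suc zero , E≡ with half-positive p 1 J≡2p (sym E≡) (s≤s z≤n)
    ...       | r , refl = row-tight₂ r J≡2p (sym E≡)

  x₀ : Vtx n
  x₀ = u zero

  2≤m : 2 ≤ m
  2≤m = ≤-pred (≤-trans (s≤s (s≤s (s≤s z≤n))) 5≤n)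

  δ-outer₁ : ∀ d (i : Fin n) → Apart d 1 (toℕ i) 0 → δ (u i) x₀ ≡ 1
  δ-outer₁ d i ap = trans (δ-arcs true true d m i zero (+-comm 1 m) ap)
                          (m≤n⇒m⊓n≡m (ladderUU-mono-≤ {1} {m} (≤-trans (s≤s z≤n) 2≤m)))

  δ-outer₂ : ∀ d (i : Fin n) → Apart d 2 (toℕ i) 0 → δ (u i) x₀ ≡ 2
  δ-outer₂ d i ap = trans (δ-arcs true true d (m ∸ 1) i zero n≡ ap) (m≤n⇒m⊓n≡m (ladderUU-mono-≤ {2} {m ∸ 1} 2≤m∸1))
    where
    n≡ : n ≡ m ∸ 1 + 2
    n≡ = trans (cong suc (sym (m∸n+n≡m (≤-trans (s≤s z≤n) 2≤m)))) (sym (+-suc (m ∸ 1) 1))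
    2≤m∸1 : 2 ≤ m ∸ 1
    2≤m∸1 = ∸-monoˡ-≤ 1 (≤-pred (≤-trans (s≤s (s≤s (s≤s (s≤s z≤n)))) 5≤n))

  δ-inner₁ : ∀ d (i : Fin n) → Apart d 1 (toℕ i) 0 → δ (v i) x₀ ≡ 2
  δ-inner₁ d i ap = trans (δ-arcs false true d m i zero (+-comm 1 m) ap)
                          (m≤n⇒m⊓n≡m (ladderUV-mono-≤ {1} {m} (≤-trans (s≤s z≤n) 2≤m)))

  n≋0 : n ≋ 0
  n≋0 = mk≋ (n%n≡0 n)

  share-last : ∀ (c j : Fin n) → toℕ c ≡ m → share x₀ (u c) (v j) ≡ (+ weight n (toℕ j)) / 2
  share-last c j c≡m = Row.row configuration
    where
    J = toℕ j
    E = m ∸ J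
    E+J≡m : E + J ≡ m
    E+J≡m = m∸n+n≡m (≤-pred (toℕ<n j))
    m∸1<n : m ∸ 1 < n
    m∸1<n = s≤s (m∸n≤m m 1)
    c₂ : Fin n
    c₂ = fromℕ< m∸1<n
    c₂≡m∸1 : toℕ c₂ ≡ m ∸ 1
    c₂≡m∸1 = toℕ-fromℕ< m∸1<n
    m∸1+1≡m : m ∸ 1 + 1 ≡ m
    m∸1+1≡m = trans (+-comm (m ∸ 1) 1) (m+[n∸m]≡n (≤-trans (s≤s z≤n) 2≤m))
    c+1≡0 : (toℕ c + 1) % n ≡ 0
    c+1≡0 = trans (cong (λ w → (w + 1) % n) c≡m) (trans (cong (_% n) (+-comm m 1)) (n%n≡0 n))
    c₂+1≋c : toℕ c₂ + 1 ≋ toℕ c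
    c₂+1≋c = ≡⇒≋ (trans (cong (_+ 1) c₂≡m∸1) (trans m∸1+1≡m (sym c≡m)))
    neighbours-s : ∀ y → Adj n (u c) y → y ≡ u zero ⊎ y ≡ u c₂ ⊎ y ≡ v c
    neighbours-s (false , _)  refl     = inj₂ (inj₂ refl)
    neighbours-s (true  , c′) (inj₁ e) = inj₁ (cong u (toℕ-injective (trans (sym e) c+1≡0)))
    neighbours-s (true  , c′) (inj₂ e) =
      inj₂ (inj₁ (cong u (toℕ-injective
        (≋⇒≡ (toℕ<n c′) (toℕ<n c₂) (+-cancelʳ-≋ 1 (≋-trans (%≡⇒≋ c e) (≋-sym c₂+1≋c)))))))
    configuration : Configuration J E
    configuration = record
      { cs = c ; cx = zero ; c₂ = c₂ ; j = j ; ds = true ; dx = true ; d₂ = true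
      ; n≡1+J+E      = cong suc (sym (trans (+-comm J E) E+J≡m))
      ; s~x          = inj₁ c+1≡0
      ; s~y₂         = inj₂ (trans (≋⇒%≡ c₂+1≋c) (m<n⇒m%n≡m (toℕ<n c)))
      ; cx≢cs        = λ 0≡c → <⇒≢ (≤-trans (s≤s z≤n) 2≤m) (trans (cong toℕ 0≡c) c≡m)
      ; neighbours-s = neighbours-s
      ; s-t          = ≡⇒≋ (trans E+J≡m (sym c≡m))
      ; x-t          = ≋-trans (≡⇒≋ (cong suc E+J≡m)) n≋0
      ; y₂-t         = λ E′ E≡1+E′ →
                         ≡⇒≋ (trans (+-cancelˡ-≡ 1 (E′ + J) (m ∸ 1)
                                       (trans (cong (_+ J) (sym E≡1+E′)) (trans E+J≡m (trans (sym m∸1+1≡m) (+-comm (m ∸ 1) 1)))))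
                                    (sym c₂≡m∸1))
      ; δsx          = δ-outer₁ false c (≋-trans (≡⇒≋ (cong suc c≡m)) n≋0)
      ; δy₂x         = δ-outer₂ false c₂
                         (≋-trans (≡⇒≋ (cong suc (trans (+-comm 1 (toℕ c₂)) (trans (cong (_+ 1) c₂≡m∸1) m∸1+1≡m)))) n≋0)
      ; δy₃x         = δ-inner₁ false c (≋-trans (≡⇒≋ (cong suc c≡m)) n≋0)
      }

  share-first′ : ∀ (c j : Fin n) → toℕ c ≡ 1 → ∀ J E → n ≡ suc (J + E) → E + 1 ≋ toℕ j →
                 share x₀ (u c) (v j) ≡ (+ weight n J) / 2
  share-first′ c j c≡1 J E n≡1+J+E E+1≋j = Row.row configuration
    where
    1<n : 1 < n
    1<n = ≤-trans (s≤s (s≤s z≤n)) 5≤n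
    2<n : 2 < n
    2<n = ≤-trans (s≤s (s≤s (s≤s z≤n))) 5≤n
    c₂ : Fin n
    c₂ = fromℕ< 2<n
    c₂≡2 : toℕ c₂ ≡ 2
    c₂≡2 = toℕ-fromℕ< 2<n
    c+1≡c₂ : (toℕ c + 1) % n ≡ toℕ c₂
    c+1≡c₂ = trans (cong (λ w → (w + 1) % n) c≡1) (trans (m<n⇒m%n≡m 2<n) (sym c₂≡2))
    neighbours-s : ∀ y → Adj n (u c) y → y ≡ u zero ⊎ y ≡ u c₂ ⊎ y ≡ v c
    neighbours-s (false , _)  refl     = inj₂ (inj₂ refl)
    neighbours-s (true  , c′) (inj₁ e) = inj₂ (inj₁ (cong u (toℕ-injective (trans (sym e) c+1≡c₂))))
    neighbours-s (true  , c′) (inj₂ e) =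
      inj₁ (cong u (toℕ-injective (≋⇒≡ (toℕ<n c′) z<s (+-cancelʳ-≋ 1 (≋-trans (%≡⇒≋ c e) (≡⇒≋ c≡1))))))
    configuration : Configuration J E
    configuration = record
      { cs = c ; cx = zero ; c₂ = c₂ ; j = j ; ds = false ; dx = false ; d₂ = false
      ; n≡1+J+E      = n≡1+J+E
      ; s~x          = inj₂ (trans (m<n⇒m%n≡m 1<n) (sym c≡1))
      ; s~y₂         = inj₁ c+1≡c₂
      ; cx≢cs        = λ 0≡c → 0≢1+n (trans (cong toℕ 0≡c) c≡1)
      ; neighbours-s = neighbours-s
      ; s-t          = ≋-trans (≡⇒≋ (cong (λ w → E + w) c≡1)) E+1≋j
      ; x-t          = ≋-trans (≡⇒≋ (trans (+-identityʳ (suc E)) (+-comm 1 E))) E+1≋j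
      ; y₂-t         = λ E′ E≡1+E′ →
                         ≋-trans (≡⇒≋ (trans (cong (λ w → E′ + w) c₂≡2) (trans (+-suc E′ 1) (cong (_+ 1) (sym E≡1+E′))))) E+1≋j
      ; δsx          = δ-outer₁ true c (≡⇒≋ (sym c≡1))
      ; δy₂x         = δ-outer₂ true c₂ (≡⇒≋ (sym c₂≡2))
      ; δy₃x         = δ-inner₁ true c (≡⇒≋ (sym c≡1))
      }

  -- (n ∸ j) % n, for j < n
  mirror : ℕ → ℕ
  mirror zero    = 0
  mirror (suc k) = m ∸ k

  share-first : ∀ (c j : Fin n) → toℕ c ≡ 1 → share x₀ (u c) (v j) ≡ (+ weight n (mirror (toℕ j))) / 2
  share-first c j c≡1 = go (toℕ j) refl
    where
    go : ∀ k → toℕ j ≡ k → share x₀ (u c) (v j) ≡ (+ weight n (mirror k)) / 2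
    go zero    j≡0   = share-first′ c j c≡1 0 m refl (≋-trans (≡⇒≋ (+-comm m 1)) (≋-trans n≋0 (≡⇒≋ (sym j≡0))))
    go (suc k) j≡1+k = share-first′ c j c≡1 (m ∸ k) k (cong suc (sym (m∸n+n≡m k≤m))) (≡⇒≋ (trans (+-comm k 1) (sym j≡1+k)))
      where
      k≤m : k ≤ m
      k≤m = ≤-pred (<⇒≤ (subst (_< n) j≡1+k (toℕ<n j)))

  offset-≥2 : ∀ d {a} (c : Fin n) → Apart d a (toℕ c) 0 → 2 ≤ toℕ c → toℕ c < m → 2 ≤ a
  offset-≥2 d     {zero}        c ap 2≤c c<m = ⊥-elim (<⇒≢ (≤-trans z<s 2≤c) (sym (apart-zero d (toℕ<n c) z<s ap)))
  offset-≥2 true  {suc zero}    c ap 2≤c c<m = ⊥-elim (<⇒≢ 2≤c (≋⇒≡ (≤-trans (s≤s (s≤s z≤n)) 5≤n) (toℕ<n c) ap))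
  offset-≥2 false {suc zero}    c ap 2≤c c<m with ≋⇒≡ (s≤s c<m) z<s ap
  ... | ()
  offset-≥2 d     {suc (suc a)} c ap 2≤c c<m = s≤s (s≤s z≤n)

  share-middle : ∀ (c j : Fin n) → 2 ≤ toℕ c → toℕ c < m → share x₀ (u c) (v j) ≡ (+ 0) / 2
  share-middle c j 2≤c c<m
    with circDist-attained true true (toℕ<n c) (z<s {n = m}) | circDist-attained true false (z<s {n = m}) (toℕ<n j)
  ... | d₁ , a₁ , ap₁ , δsx≡ | d₂ , a₂ , ap₂ , δxt≡ with apart-trans d₁ d₂ ap₁ ap₂
  ...   | d , a , ap , a≤a₁+a₂ =
    trans (cong (λ w → frac w (σ n (u c) (v j))) (σvia-off-geodesic (u c) (v j) x₀ detour)) (frac-zero (σ n (u c) (v j)))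
    where
    detour : δ (u c) (v j) < δ (u c) x₀ + δ x₀ (v j)
    detour = begin-strict
      δ (u c) (v j)               ≤⟨ δ-≤-ladder true false d c j ap ⟩
      ladderUV a                  ≤⟨ ladderUV-mono-≤ a≤a₁+a₂ ⟩
      ladderUV (a₁ + a₂)          <⟨ ladderUV-<-detour a₁ a₂ (offset-≥2 d₁ c ap₁ 2≤c c<m) ⟩
      ladderUU a₁ + ladderUV a₂   ≡⟨ cong₂ _+_ δsx≡ δxt≡ ⟨
      δ (u c) x₀ + δ x₀ (v j)     ∎
      where open ≤-Reasoning

  pairWeight : Fin n → ℕ → ℕ
  pairWeight c j with toℕ c ≟ m | toℕ c ≟ 1
  ... | yes _ | _     = weight n j
  ... | no  _ | yes _ = weight n (mirror j)
  ... | no  _ | no  _ = 0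

  share-pair : ∀ c j → c ≢ zero → share x₀ (u c) (v j) ≡ (+ pairWeight c (toℕ j)) / 2
  share-pair c j c≢0 with toℕ c ≟ m | toℕ c ≟ 1
  ... | yes c≡m | _       = share-last c j c≡m
  ... | no  _   | yes c≡1 = share-first c j c≡1
  ... | no  c≢m | no  c≢1 = share-middle c j (2≤ (toℕ c) (c≢0 ∘ toℕ-injective) c≢1) (≤∧≢⇒< (≤-pred (toℕ<n c)) c≢m)
    where
    2≤ : ∀ k → k ≢ 0 → k ≢ 1 → 2 ≤ k
    2≤ zero          k≢0 _   = ⊥-elim (k≢0 refl)
    2≤ (suc zero)    _   k≢1 = ⊥-elim (k≢1 refl)
    2≤ (suc (suc k)) _   _   = s≤s (s≤s z≤n)

  pairWeight-last : ∀ c j → toℕ c ≡ m → pairWeight c j ≡ weight n j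
  pairWeight-last c j c≡m with toℕ c ≟ m
  ... | yes _   = refl
  ... | no  c≢m = ⊥-elim (c≢m c≡m)

  pairWeight-first : ∀ c j → toℕ c ≡ 1 → pairWeight c j ≡ weight n (mirror j)
  pairWeight-first c j c≡1 with toℕ c ≟ m | toℕ c ≟ 1
  ... | yes c≡m | _       = ⊥-elim (1+n≰n (subst (2 ≤_) (trans (sym c≡m) c≡1) 2≤m))
  ... | no  _   | yes _   = refl
  ... | no  _   | no  c≢1 = ⊥-elim (c≢1 c≡1)

  pairWeight-middle : ∀ c j → toℕ c ≢ m → toℕ c ≢ 1 → pairWeight c j ≡ 0
  pairWeight-middle c j c≢m c≢1 with toℕ c ≟ m | toℕ c ≟ 1
  ... | yes c≡m | _       = ⊥-elim (c≢m c≡m)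
  ... | no  _   | yes c≡1 = ⊥-elim (c≢1 c≡1)
  ... | no  _   | no  _   = refl

  S T : List (Vtx n)
  S = filter (λ s → ¬? (s ≟V x₀)) (Uset n)
  T = filter (λ t → ¬? (t ≟V x₀)) (Vset n)

  pairWeightᵥ : Vtx n × Vtx n → ℕ
  pairWeightᵥ ((_ , c) , (_ , j)) = pairWeight c (toℕ j)

  B≡∑pairWeight : B n x₀ (Uset n) (Vset n) ≡ (+ ∑ pairWeightᵥ (cartesianProduct S T)) / 2
  B≡∑pairWeight = sumℚ-halves (cartesianProduct S T) (λ st → share x₀ (proj₁ st) (proj₂ st)) pairWeightᵥ pointwise
    where
    pointwise : ∀ {st} → st ∈ cartesianProduct S T → share x₀ (proj₁ st) (proj₂ st) ≡ (+ pairWeightᵥ st) / 2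
    pointwise {s , t} st∈ with ∈-cartesianProduct⁻ S T st∈
    ... | s∈S , t∈T
      with ∈-filter⁻ (λ s → ¬? (s ≟V x₀)) {xs = Uset n} s∈S | ∈-filter⁻ (λ t → ¬? (t ≟V x₀)) {xs = Vset n} t∈T
    ...   | s∈U , s≢x₀ | t∈V , _ with ∈-map⁻ u s∈U | ∈-map⁻ v t∈V
    ...     | c , _ , refl | j , _ , refl = share-pair c j (s≢x₀ ∘ cong u)

  rowSum : Vtx n → ℕ
  rowSum s = ∑ (λ t → pairWeightᵥ (s , t)) T

  rowSum≡∑< : ∀ c → rowSum (u c) ≡ ∑< n (pairWeight c)
  rowSum≡∑< c = trans (∑-filter-all (λ t → ¬? (t ≟V x₀)) _ (Vset n) inner≢x₀)
                      (trans (∑-map _ v (allFin n)) (∑-tabulate n (λ i → i) _ (pairWeight c) (λ _ → refl)))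
    where
    inner≢x₀ : ∀ {t} → t ∈ Vset n → t ≢ x₀
    inner≢x₀ t∈V t≡x₀ with ∈-map⁻ v t∈V
    inner≢x₀ t∈V ()  | _ , _ , refl

  1<n : 1 < n
  1<n = ≤-trans (s≤s (s≤s z≤n)) 5≤n

  c₁ cₘ : Fin n
  c₁ = fromℕ< 1<n
  cₘ = fromℕ< (n<1+n m)

  rowSum-first : rowSum (u c₁) ≡ ⌊ n /2⌋
  rowSum-first = begin
    rowSum (u c₁)                          ≡⟨ rowSum≡∑< c₁ ⟩
    ∑< n (pairWeight c₁)                   ≡⟨ ∑<-cong n (λ {j} _ → pairWeight-first c₁ j (toℕ-fromℕ< 1<n)) ⟩
    ∑< n (λ j → weight n (mirror j))       ≡⟨ cong (λ w → weight n 0 + w) (∑<-reverse m (weight n)) ⟩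
    ∑< n (weight n)                        ≡⟨ ∑-weight n ⟩
    ⌊ n /2⌋                                ∎
    where open ≡-Reasoning

  rowSum-last : rowSum (u cₘ) ≡ ⌊ n /2⌋
  rowSum-last = begin
    rowSum (u cₘ)          ≡⟨ rowSum≡∑< cₘ ⟩
    ∑< n (pairWeight cₘ)   ≡⟨ ∑<-cong n (λ {j} _ → pairWeight-last cₘ j (toℕ-fromℕ< (n<1+n m))) ⟩
    ∑< n (weight n)        ≡⟨ ∑-weight n ⟩
    ⌊ n /2⌋                ∎
    where open ≡-Reasoning

  rowSum-middle : ∀ {s} → s ∈ S → s ≢ u c₁ → s ≢ u cₘ → rowSum s ≡ 0
  rowSum-middle s∈S s≢u₁ s≢uₘ with ∈-map⁻ u (proj₁ (∈-filter⁻ (λ s → ¬? (s ≟V x₀)) {xs = Uset n} s∈S))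
  ... | c , _ , refl = trans (rowSum≡∑< c) (∑<-zero n (λ {j} _ → pairWeight-middle c j c≢m c≢1))
    where
    c≢m : toℕ c ≢ m
    c≢m c≡m = s≢uₘ (cong u (toℕ-injective (trans c≡m (sym (toℕ-fromℕ< (n<1+n m))))))
    c≢1 : toℕ c ≢ 1
    c≢1 c≡1 = s≢u₁ (cong u (toℕ-injective (trans c≡1 (sym (toℕ-fromℕ< 1<n)))))

  S-unique : Unique S
  S-unique = Unique.filter⁺ (λ s → ¬? (s ≟V x₀)) (Unique.map⁺ u-injective (Unique.allFin⁺ n))
    where
    u-injective : ∀ {c c′ : Fin n} → u c ≡ u c′ → c ≡ c′
    u-injective refl = refl

  ∈S : ∀ c → c ≢ zero → u c ∈ S
  ∈S c c≢0 = ∈-filter⁺ (λ s → ¬? (s ≟V x₀)) (∈-map⁺ u (∈-allFin c)) (c≢0 ∘ cong proj₂)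

  B≡⌊n/2⌋+⌊n/2⌋ : B n x₀ (Uset n) (Vset n) ≡ (+ (⌊ n /2⌋ + ⌊ n /2⌋)) / 2
  B≡⌊n/2⌋+⌊n/2⌋ = trans B≡∑pairWeight (cong (λ w → (+ w) / 2) (begin
    ∑ pairWeightᵥ (cartesianProduct S T)  ≡⟨ ∑-cartesianProduct pairWeightᵥ S T ⟩
    ∑ rowSum S                            ≡⟨ ∑-pair S-unique (∈S c₁ c₁≢0) (∈S cₘ cₘ≢0) u₁≢uₘ rowSum-middle ⟩
    rowSum (u c₁) + rowSum (u cₘ)         ≡⟨ cong₂ _+_ rowSum-first rowSum-last ⟩
    ⌊ n /2⌋ + ⌊ n /2⌋                     ∎))
    where
    open ≡-Reasoning
    c₁≢0 : c₁ ≢ zero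
    c₁≢0 c₁≡0 = 0≢1+n (sym (trans (sym (toℕ-fromℕ< 1<n)) (cong toℕ c₁≡0)))
    cₘ≢0 : cₘ ≢ zero
    cₘ≢0 cₘ≡0 = <⇒≢ (≤-trans z<s 2≤m) (sym (trans (sym (toℕ-fromℕ< (n<1+n m))) (cong toℕ cₘ≡0)))
    u₁≢uₘ : u c₁ ≢ u cₘ
    u₁≢uₘ u₁≡uₘ = <⇒≢ (≤-trans (s≤s (s≤s z≤n)) 2≤m)
                      (trans (sym (toℕ-fromℕ< 1<n)) (trans (cong (toℕ ∘ proj₂) u₁≡uₘ) (toℕ-fromℕ< (n<1+n m))))

mainTheorem17 : (m : ℕ) →
    ((13 ≤ suc m → suc m % 2 ≡ 1 → B (suc m) (u zero) (Uset (suc m)) (Vset (suc m)) ≡ (+ (suc m ∸ 1)) / 2)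
    × (12 ≤ suc m → suc m % 2 ≡ 0 → B (suc m) (u zero) (Uset (suc m)) (Vset (suc m)) ≡ (+ suc m) / 2))
mainTheorem17 m = odd , even
  where
  h = ⌊ suc m /2⌋
  odd : 13 ≤ suc m → suc m % 2 ≡ 1 → B (suc m) (u zero) (Uset (suc m)) (Vset (suc m)) ≡ (+ (suc m ∸ 1)) / 2
  odd 13≤n n%2≡1 = trans (Betweenness.B≡⌊n/2⌋+⌊n/2⌋ m (≤-trans (s≤s (s≤s (s≤s (s≤s (s≤s z≤n))))) 13≤n))
                         (cong (λ w → (+ w) / 2) (suc-injective (trans (+-comm 1 (h + h)) h+h+1≡n)))
    where
    h+h+1≡n : h + h + 1 ≡ suc m
    h+h+1≡n = subst (λ r → h + h + r ≡ suc m) n%2≡1 (⌊n/2⌋+⌊n/2⌋+n%2≡n (suc m))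
  even : 12 ≤ suc m → suc m % 2 ≡ 0 → B (suc m) (u zero) (Uset (suc m)) (Vset (suc m)) ≡ (+ suc m) / 2
  even 12≤n n%2≡0 = trans (Betweenness.B≡⌊n/2⌋+⌊n/2⌋ m (≤-trans (s≤s (s≤s (s≤s (s≤s (s≤s z≤n))))) 12≤n))
                          (cong (λ w → (+ w) / 2) (trans (sym (+-identityʳ (h + h))) h+h+0≡n))
    where
    h+h+0≡n : h + h + 0 ≡ suc m
    h+h+0≡n = subst (λ r → h + h + r ≡ suc m) n%2≡0 (⌊n/2⌋+⌊n/2⌋+n%2≡n (suc m))
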